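{- Let $n$ be a positive multiple of four. Let $Y_n$ be the graph whose vertices are the unordered pairs $\{A,[n]\setminus A\}$ where $A$ is a subset of $[n]=\{1,\dots,n\}$ of even size, two such pairs $\{A,[n]\setminus A\}$ and $\{B,[n]\setminus B\}$ being adjacent if and only if $|A\triangle B|=n/2$. Then \[ \alpha(Y_n)\leq \frac14\cdot\frac{2^n}{n}. \] Furthermore, if equality holds, then the characteristic vector of any maximum independent set of $Y_n$ lies in the column space of $\widetilde H=\begin{pmatrix}H&\mathbf 1\end{pmatrix}$, where $H$ is the matrix with rows indexed by the vertices of $Y_n$ and columns indexed by the $2$-subsets $p$ of $[n]$, whose entry in row $\{A,[n]\setminus A\}$ and column $p$ is $(-1)^{|A\cap p|}$, and $\mathbf 1$ is the all-ones column vector.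
   Context: The entry $(-1)^{|A\cap p|}$ does not depend on which representative $A$ of the pair is used, since $|p|=2$. Equivalently, $Y_n$ is obtained from the graph on $\pm1$-vectors of length $n$ with an even number of $-1$'s (adjacency = orthogonality) by identifying each vector $x$ with $-x$. $\alpha$ denotes the independence number. -}

module Defs where

open import Data.Nat using (ℕ; zero; suc; _*_; _≤_; _<_; _^_)
open import Data.Nat.Divisibility using (_∣_)
open import Data.Nat.DivMod using (_/_)
open import Data.Fin using (Fin; toℕ)
open import Data.Fin.Subset using (Subset; ∣_∣; _∩_; _∪_; _─_; ⁅_⁆; _∉_)
open import Data.Bool using (if_then_else_; _≟_)
open import Data.Vec.Properties using (≡-dec)
open import Data.List using (List; []; _∷_; foldr; map; concatMap; filter; length; allFin)
open import Data.List.Membership.Propositional using (_∈_)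
import Data.List.Membership.DecPropositional as DecMem
open import Data.List.Relation.Unary.Unique.Propositional using (Unique)
open import Data.Product using (_×_; Σ; ∃)
open import Data.Fin.Properties using (_<?_)
open import Data.Rational using (ℚ; 0ℚ; 1ℚ; -_; _+_)
import Data.Rational as Q
open import Relation.Nullary using (¬_; does)
open import Relation.Binary.PropositionalEquality using (_≡_)

_△_ : ∀ {n} → Subset n → Subset n → Subset n
A △ B = (A ─ B) ∪ (B ─ A)

-- Vertices of Y_n: the pair {A, [n] \ A} is represented by its unique
-- member A not containing the first element of [n] (Fin index 0).
-- |A| must be even.
IsVertex : (n : ℕ) → Subset n → Set
IsVertex n A = (2 ∣ ∣ A ∣) × (∀ (i : Fin n) → toℕ i ≡ 0 → i ∉ A)

-- adjacency in Y_n : |A △ B| = n/2  (independent of representatives)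
Adjacent : (n : ℕ) → Subset n → Subset n → Set
Adjacent n A B = ∣ A △ B ∣ ≡ n / 2

IsIndependent : (n : ℕ) → List (Subset n) → Set
IsIndependent n S =
  Unique S × (∀ A → A ∈ S → IsVertex n A) ×
  (∀ A B → A ∈ S → B ∈ S → ¬ Adjacent n A B)

IsMaximumIndependent : (n : ℕ) → List (Subset n) → Set
IsMaximumIndependent n S =
  IsIndependent n S × (∀ T → IsIndependent n T → length T ≤ length S)

χ : ∀ {n} → List (Subset n) → Subset n → ℚ
χ {n} S A = if does (A ∈? S) then 1ℚ else 0ℚ
  where open DecMem (≡-dec {n = n} _≟_) using (_∈?_)

signPow : ℕ → ℚ
signPow zero = 1ℚ
signPow (suc k) = - signPow k

twoSubsets : (n : ℕ) → List (Fin n × Fin n)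
twoSubsets n = concatMap (λ i → map (λ j → (i Data.Product., j))
                 (filter (λ j → i <? j) (allFin n))) (allFin n)

pairSet : ∀ {n} → Fin n × Fin n → Subset n
pairSet (i Data.Product., j) = ⁅ i ⁆ ∪ ⁅ j ⁆

sumℚ : List ℚ → ℚ
sumℚ = foldr _+_ 0ℚ

H : ∀ {n} → Subset n → Fin n × Fin n → ℚ
H A p = signPow ∣ A ∩ pairSet p ∣

InColumnSpaceH~ : (n : ℕ) → (Subset n → ℚ) → Set
InColumnSpaceH~ n x =
  Σ (Fin n × Fin n → ℚ) λ c → Σ ℚ λ d →
    ∀ A → IsVertex n A →
      x A ≡ sumℚ (map (λ p → H A p Q.* c p) (twoSubsets n)) + d

{-# OPTIONS --safe #-}
-- Let n = 2m with m even. An independent set T of Yₙ lifts to the 0/1 function g on subsets of [n]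
-- marking both representatives A and [n] ∖ A of each vertex of T: g lives on even sets, ∑ g = 2|T|,
-- and g(x)·g(x △ D) = 0 whenever |D| = m. By Wiener–Khinchin the latter says ∑_J K_m(|J|) ĝ(J)² = 0
-- for the Walsh–Fourier transform ĝ and the Krawtchouk polynomial K_m. The weight
-- (n − 1)K_m(w) + C(n,m) is nonnegative for 0 < w < n: by Krawtchouk reciprocity this is
-- C(2m,2j) ≥ (2m − 1)C(m,j), tight only for w ∈ {2, n − 2}. At w = 0 and w = n, where ĝ = ∑ g, it
-- equals n·C(n,m); subtracting that value there, Parseval's identity gives
--   0 ≤ ∑_J weight(|J|) ĝ(J)² = C(n,m) · S · (2ⁿ − 2nS),   S = ∑ g = 2|T|,
-- so 4n|T| ≤ 2ⁿ. At equality ĝ vanishes off the levels 0, 2, n − 2, n; as ĝ(∁J) = ĝ(J), Fourier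
-- inversion then writes g on even sets as a constant plus a combination of the (−1)^{|A ∩ p|}, |p| = 2.
module Submission where

open import Data.Nat as ℕ using (ℕ)
open import Relation.Binary.PropositionalEquality using (_≡_)

module IntegerFacts where

  open import Data.Nat using (zero; suc; z≤n)
  open import Data.Nat.Properties using (+-suc)
  open import Data.Integer using (ℤ; +_; -[1+_]; 0ℤ; 1ℤ; -1ℤ; _*_; _^_; _≤_; _<_; +≤+; positive)
  open import Data.Integer.Properties using (pos-*; *-assoc; *-identityˡ; *-cancelˡ-≤-pos; *-monoˡ-<-pos)
  open import Relation.Binary.PropositionalEquality using (refl; subst; cong; sym; trans)

  -1^-even : ∀ i → -1ℤ ^ (i ℕ.+ i) ≡ 1ℤ
  -1^-even zero = refl
  -1^-even (suc i) = trans (cong (λ k → -1ℤ * -1ℤ ^ k) (+-suc i i))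
    (trans (sym (*-assoc -1ℤ -1ℤ (-1ℤ ^ (i ℕ.+ i)))) (trans (*-identityˡ _) (-1^-even i)))

  square-nonneg : ∀ i → 0ℤ ≤ i * i
  square-nonneg (+ a) = subst (0ℤ ≤_) (pos-* a a) (+≤+ z≤n)
  square-nonneg -[1+ a ] = +≤+ z≤n

  *-nonneg : ∀ {i j} → 0ℤ ≤ i → 0ℤ ≤ j → 0ℤ ≤ i * j
  *-nonneg {+ a} {+ b} _ _ = subst (0ℤ ≤_) (pos-* a b) (+≤+ z≤n)

  pos-2^ : ∀ n → (+ 2) ^ n ≡ + (2 ℕ.^ n)
  pos-2^ zero = refl
  pos-2^ (suc n) = trans (cong (+ 2 *_) (pos-2^ n)) (sym (pos-* 2 (2 ℕ.^ n)))

  -- Taking 0 < k explicitly keeps Agda from normalising k, as instantiating the library's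
  -- instance argument at a binomial coefficient would.
  *-cancelˡ-≤-0< : ∀ {i j k} → 0ℤ < k → k * i ≤ k * j → i ≤ j
  *-cancelˡ-≤-0< {i} {j} {k} 0<k = *-cancelˡ-≤-pos i j k {{positive 0<k}}

  *-monoˡ-<-0< : ∀ {i j k} → 0ℤ < k → i < j → k * i < k * j
  *-monoˡ-<-0< {k = k} 0<k = *-monoˡ-<-pos k {{positive 0<k}}

module CubeSum where

  open import Data.Bool using (Bool; true; false)
  open import Data.Nat using (zero; suc)
  open import Data.Integer using (ℤ; 0ℤ; 1ℤ; _+_; _*_; _≤_)
  open import Data.Integer.Properties
  open import Algebra.Properties.CommutativeSemigroup +-commutativeSemigroup using () renaming (interchange to +-interchange)
  open import Data.Product using (_×_; _,_)
  open import Data.Vec using ([]; _∷_)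
  open import Data.Fin.Subset using (Subset; ∁)
  open import Relation.Binary.PropositionalEquality
  open import Relation.Nullary using (contradiction)
  open import Function using (_∘_)
  open import Defs using (_△_)
  open ≡-Reasoning

  ∑ : ∀ {n} → (Subset n → ℤ) → ℤ
  ∑ {zero} f = f []
  ∑ {suc n} f = ∑ (λ x → f (false ∷ x)) + ∑ (λ x → f (true ∷ x))

  ∑-cong : ∀ {n} {f g : Subset n → ℤ} → (∀ x → f x ≡ g x) → ∑ f ≡ ∑ g
  ∑-cong {zero} f≡g = f≡g []
  ∑-cong {suc n} f≡g = cong₂ _+_ (∑-cong (λ x → f≡g (false ∷ x))) (∑-cong (λ x → f≡g (true ∷ x)))

  ∑-0 : ∀ {n} → ∑ {n} (λ _ → 0ℤ) ≡ 0ℤ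
  ∑-0 {zero} = refl
  ∑-0 {suc n} = cong₂ _+_ (∑-0 {n}) (∑-0 {n})

  ∑-+ : ∀ {n} (f g : Subset n → ℤ) → ∑ (λ x → f x + g x) ≡ ∑ f + ∑ g
  ∑-+ {zero} f g = refl
  ∑-+ {suc n} f g = begin
    ∑ (λ x → f (false ∷ x) + g (false ∷ x)) + ∑ (λ x → f (true ∷ x) + g (true ∷ x))
      ≡⟨ cong₂ _+_ (∑-+ {n} _ _) (∑-+ {n} _ _) ⟩
    (∑ (λ x → f (false ∷ x)) + ∑ (λ x → g (false ∷ x))) + (∑ (λ x → f (true ∷ x)) + ∑ (λ x → g (true ∷ x)))
      ≡⟨ +-interchange (∑ {n} (λ x → f (false ∷ x))) (∑ {n} (λ x → g (false ∷ x))) _ _ ⟩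
    ∑ f + ∑ g ∎

  ∑-*ˡ : ∀ {n} (c : ℤ) (f : Subset n → ℤ) → ∑ (λ x → c * f x) ≡ c * ∑ f
  ∑-*ˡ {zero} c f = refl
  ∑-*ˡ {suc n} c f = trans (cong₂ _+_ (∑-*ˡ {n} c _) (∑-*ˡ {n} c _)) (sym (*-distribˡ-+ c _ _))

  ∑-linear : ∀ {n} (a b : ℤ) (f g : Subset n → ℤ) → ∑ (λ x → a * f x + b * g x) ≡ a * ∑ f + b * ∑ g
  ∑-linear {n} a b f g = trans (∑-+ {n} _ _) (cong₂ _+_ (∑-*ˡ a f) (∑-*ˡ b g))

  ∑-*ʳ : ∀ {n} (c : ℤ) (f : Subset n → ℤ) → ∑ (λ x → f x * c) ≡ ∑ f * c
  ∑-*ʳ {n} c f = trans (∑-cong {n} (λ x → *-comm (f x) c)) (trans (∑-*ˡ c f) (*-comm c _))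

  ∑-swap : ∀ {n k} (f : Subset n → Subset k → ℤ) → ∑ (λ x → ∑ (λ y → f x y)) ≡ ∑ (λ y → ∑ (λ x → f x y))
  ∑-swap {zero} f = refl
  ∑-swap {suc n} {k} f = begin
    ∑ (λ x → ∑ (λ y → f (false ∷ x) y)) + ∑ (λ x → ∑ (λ y → f (true ∷ x) y))
      ≡⟨ cong₂ _+_ (∑-swap (λ x → f (false ∷ x))) (∑-swap (λ x → f (true ∷ x))) ⟩
    ∑ (λ y → ∑ (λ x → f (false ∷ x) y)) + ∑ (λ y → ∑ (λ x → f (true ∷ x) y))
      ≡⟨ ∑-+ {k} _ _ ⟨
    ∑ (λ y → ∑ (λ x → f x y)) ∎

  ∑-∁ : ∀ {n} (f : Subset n → ℤ) → ∑ (λ x → f (∁ x)) ≡ ∑ f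
  ∑-∁ {zero} f = refl
  ∑-∁ {suc n} f = trans (cong₂ _+_ (∑-∁ (λ x → f (true ∷ x))) (∑-∁ (λ x → f (false ∷ x)))) (+-comm (∑ {n} (λ x → f (true ∷ x))) _)

  ∑-nonneg : ∀ {n} (f : Subset n → ℤ) → (∀ x → 0ℤ ≤ f x) → 0ℤ ≤ ∑ f
  ∑-nonneg {zero} f f≥0 = f≥0 []
  ∑-nonneg {suc n} f f≥0 = +-mono-≤ (∑-nonneg _ (λ x → f≥0 (false ∷ x))) (∑-nonneg _ (λ x → f≥0 (true ∷ x)))

  nonneg-+≡0 : ∀ {a b} → 0ℤ ≤ a → 0ℤ ≤ b → a + b ≡ 0ℤ → a ≡ 0ℤ × b ≡ 0ℤ
  nonneg-+≡0 {a} {b} a≥0 b≥0 a+b≡0 = ≤-antisym a≤0 a≥0 , ≤-antisym b≤0 b≥0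
    where
    a≤0 : a ≤ 0ℤ
    a≤0 = ≤-trans (≤-trans (≤-reflexive (sym (+-identityʳ a))) (+-monoʳ-≤ a b≥0)) (≤-reflexive a+b≡0)
    b≤0 : b ≤ 0ℤ
    b≤0 = ≤-trans (≤-trans (≤-reflexive (sym (+-identityˡ b))) (+-monoˡ-≤ b a≥0)) (≤-reflexive a+b≡0)

  ∑-nonneg-≡0 : ∀ {n} (f : Subset n → ℤ) → (∀ x → 0ℤ ≤ f x) → ∑ f ≡ 0ℤ → ∀ x → f x ≡ 0ℤ
  ∑-nonneg-≡0 {zero} f f≥0 ∑f≡0 [] = ∑f≡0
  ∑-nonneg-≡0 {suc n} f f≥0 ∑f≡0 (b ∷ x) with nonneg-+≡0 (∑-nonneg _ (λ y → f≥0 (false ∷ y))) (∑-nonneg _ (λ y → f≥0 (true ∷ y))) ∑f≡0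
  ... | ∑₀≡0 , ∑₁≡0 with b
  ...   | false = ∑-nonneg-≡0 _ (λ y → f≥0 (false ∷ y)) ∑₀≡0 x
  ...   | true = ∑-nonneg-≡0 _ (λ y → f≥0 (true ∷ y)) ∑₁≡0 x

  δ₂ : Bool → Bool → ℤ
  δ₂ false false = 1ℤ
  δ₂ true true = 1ℤ
  δ₂ _ _ = 0ℤ

  δ : ∀ {n} → Subset n → Subset n → ℤ
  δ [] [] = 1ℤ
  δ (a ∷ x) (b ∷ y) = δ₂ a b * δ x y

  ∑-δ : ∀ {n} (z : Subset n) (f : Subset n → ℤ) → ∑ (λ x → δ x z * f x) ≡ f z
  ∑-δ [] f = *-identityˡ _
  ∑-δ {suc n} (false ∷ z) f = begin
    ∑ (λ x → (1ℤ * δ x z) * f (false ∷ x)) + ∑ (λ x → (0ℤ * δ x z) * f (true ∷ x))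
      ≡⟨ cong₂ _+_ (∑-cong {n} (λ x → cong (_* f (false ∷ x)) (*-identityˡ (δ x z))))
                   (trans (∑-cong {n} (λ x → trans (cong (_* f (true ∷ x)) (*-zeroˡ (δ x z))) (*-zeroˡ (f (true ∷ x))))) (∑-0 {n})) ⟩
    ∑ (λ x → δ x z * f (false ∷ x)) + 0ℤ ≡⟨ +-identityʳ _ ⟩
    ∑ (λ x → δ x z * f (false ∷ x)) ≡⟨ ∑-δ z _ ⟩
    f (false ∷ z) ∎
  ∑-δ {suc n} (true ∷ z) f = begin
    ∑ (λ x → (0ℤ * δ x z) * f (false ∷ x)) + ∑ (λ x → (1ℤ * δ x z) * f (true ∷ x))
      ≡⟨ cong₂ _+_ (trans (∑-cong {n} (λ x → trans (cong (_* f (false ∷ x)) (*-zeroˡ (δ x z))) (*-zeroˡ (f (false ∷ x))))) (∑-0 {n}))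
                   (∑-cong {n} (λ x → cong (_* f (true ∷ x)) (*-identityˡ (δ x z)))) ⟩
    0ℤ + ∑ (λ x → δ x z * f (true ∷ x)) ≡⟨ +-identityˡ _ ⟩
    ∑ (λ x → δ x z * f (true ∷ x)) ≡⟨ ∑-δ z _ ⟩
    f (true ∷ z) ∎

  δ-refl : ∀ {n} (x : Subset n) → δ x x ≡ 1ℤ
  δ-refl [] = refl
  δ-refl (true ∷ x) = trans (*-identityˡ _) (δ-refl x)
  δ-refl (false ∷ x) = trans (*-identityˡ _) (δ-refl x)

  δ-≢ : ∀ {n} (x y : Subset n) → x ≢ y → δ x y ≡ 0ℤ
  δ-≢ [] [] x≢y = contradiction refl x≢y
  δ-≢ (true ∷ x) (false ∷ y) _ = refl
  δ-≢ (false ∷ x) (true ∷ y) _ = refl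
  δ-≢ (true ∷ x) (true ∷ y) x≢y = trans (*-identityˡ _) (δ-≢ x y (x≢y ∘ cong (true ∷_)))
  δ-≢ (false ∷ x) (false ∷ y) x≢y = trans (*-identityˡ _) (δ-≢ x y (x≢y ∘ cong (false ∷_)))

  ∑-△ : ∀ {n} (f : Subset n → ℤ) (d : Subset n) → ∑ (λ x → f (x △ d)) ≡ ∑ f
  ∑-△ {zero} f [] = refl
  ∑-△ {suc n} f (false ∷ d) = cong₂ _+_ (∑-△ (λ x → f (false ∷ x)) d) (∑-△ (λ x → f (true ∷ x)) d)
  ∑-△ {suc n} f (true ∷ d) =
    trans (cong₂ _+_ (∑-△ (λ x → f (true ∷ x)) d) (∑-△ (λ x → f (false ∷ x)) d)) (+-comm (∑ {n} (λ x → f (true ∷ x))) _)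

module HammingLevels where

  open import Data.Bool using (true; false; if_then_else_)
  open import Data.Nat using (zero; suc; s≤s; _∸_)
  import Data.Nat.Properties as ℕ
  open import Function using (_∘_)
  open import Data.Integer using (ℤ; +_; 0ℤ; 1ℤ; _+_; _*_; _-_)
  open import Data.Integer.Properties
  open import Data.Vec using ([]; _∷_)
  open import Data.Fin.Subset using (Subset; ∣_∣; ∁; ⊥; ⊤)
  open import Data.Fin.Subset.Properties using (∣p∣≤n; ∣∁p∣≡n∸∣p∣)
  open import Data.Nat.Combinatorics using (_C_; nCk+nC[k+1]≡[n+1]C[k+1])
  open import Relation.Binary.PropositionalEquality
  open import Relation.Nullary using (does; yes; no; ¬_)
  open import Relation.Nullary.Decidable using (dec-true; dec-false)
  open ≡-Reasoning
  open CubeSum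

  𝟙[_≡_] : ℕ → ℕ → ℤ
  𝟙[ a ≡ b ] = if does (a ℕ.≟ b) then 1ℤ else 0ℤ

  𝟙-≡ : ∀ {a b} → a ≡ b → 𝟙[ a ≡ b ] ≡ 1ℤ
  𝟙-≡ {a} {b} a≡b rewrite dec-true (a ℕ.≟ b) a≡b = refl

  𝟙-≢ : ∀ {a b} → ¬ a ≡ b → 𝟙[ a ≡ b ] ≡ 0ℤ
  𝟙-≢ {a} {b} a≢b rewrite dec-false (a ℕ.≟ b) a≢b = refl

  𝟙-subst : ∀ a b (f : ℕ → ℤ) → 𝟙[ a ≡ b ] * f a ≡ 𝟙[ a ≡ b ] * f b
  𝟙-subst a b f with a ℕ.≟ b
  ... | yes refl = refl
  ... | no a≢b rewrite 𝟙-≢ a≢b = refl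

  𝟙-sym : ∀ a b → 𝟙[ a ≡ b ] ≡ 𝟙[ b ≡ a ]
  𝟙-sym a b with a ℕ.≟ b
  ... | yes refl = refl
  ... | no a≢b = trans (𝟙-≢ a≢b) (sym (𝟙-≢ (a≢b ∘ sym)))

  𝟙-complement-* : ∀ a b → (1ℤ - 𝟙[ a ≡ b ]) * 𝟙[ a ≡ b ] ≡ 0ℤ
  𝟙-complement-* a b with a ℕ.≟ b
  ... | yes a≡b rewrite 𝟙-≡ a≡b = refl
  ... | no a≢b rewrite 𝟙-≢ a≢b = refl

  𝟙-∁ : ∀ {n k} → k ℕ.≤ n → (J : Subset n) → 𝟙[ ∣ ∁ J ∣ ≡ n ∸ k ] ≡ 𝟙[ ∣ J ∣ ≡ k ]
  𝟙-∁ {n} {k} k≤n J rewrite ∣∁p∣≡n∸∣p∣ J with ∣ J ∣ ℕ.≟ k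
  ... | yes refl = trans (𝟙-≡ {n ∸ ∣ J ∣} refl) (sym (𝟙-≡ {∣ J ∣} refl))
  ... | no |J|≢k = trans (𝟙-≢ (|J|≢k ∘ ℕ.∸-cancelˡ-≡ (∣p∣≤n J) k≤n)) (sym (𝟙-≢ |J|≢k))

  ∑-level-0 : ∀ {n} (f : Subset n → ℤ) → ∑ (λ J → 𝟙[ ∣ J ∣ ≡ 0 ] * f J) ≡ f ⊥
  ∑-level-0 {zero} f = *-identityˡ (f [])
  ∑-level-0 {suc n} f = begin
    ∑ (λ J → 𝟙[ ∣ J ∣ ≡ 0 ] * f (false ∷ J)) + ∑ (λ J → 0ℤ * f (true ∷ J))
      ≡⟨ cong₂ _+_ (∑-level-0 (λ J → f (false ∷ J))) (trans (∑-cong {n} (λ J → *-zeroˡ (f (true ∷ J)))) (∑-0 {n})) ⟩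
    f ⊥ + 0ℤ ≡⟨ +-identityʳ (f ⊥) ⟩
    f ⊥ ∎

  ∑-level-top : ∀ {n} (f : Subset n → ℤ) → ∑ (λ J → 𝟙[ ∣ J ∣ ≡ n ] * f J) ≡ f ⊤
  ∑-level-top {zero} f = *-identityˡ (f [])
  ∑-level-top {suc n} f = begin
    ∑ (λ J → 𝟙[ ∣ J ∣ ≡ suc n ] * f (false ∷ J)) + ∑ (λ J → 𝟙[ ∣ J ∣ ≡ n ] * f (true ∷ J))
      ≡⟨ cong₂ _+_ (trans (∑-cong {n} (λ J → cong (_* f (false ∷ J)) (𝟙-≢ (ℕ.<⇒≢ (s≤s (∣p∣≤n J))))))
                          (trans (∑-cong {n} (λ J → *-zeroˡ (f (false ∷ J)))) (∑-0 {n})))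
                   (∑-level-top (λ J → f (true ∷ J))) ⟩
    0ℤ + f ⊤ ≡⟨ +-identityˡ (f ⊤) ⟩
    f ⊤ ∎

  level-count : ∀ n w → ∑ {n} (λ J → 𝟙[ ∣ J ∣ ≡ w ]) ≡ + (n C w)
  level-count zero zero = refl
  level-count zero (suc w) = refl
  level-count (suc n) zero = cong₂ _+_ (level-count n zero) (∑-0 {n})
  level-count (suc n) (suc w) = begin
    ∑ {n} (λ J → 𝟙[ ∣ J ∣ ≡ suc w ]) + ∑ {n} (λ J → 𝟙[ ∣ J ∣ ≡ w ]) ≡⟨ cong₂ _+_ (level-count n (suc w)) (level-count n w) ⟩
    + (n C suc w) + + (n C w) ≡⟨ +-comm (+ (n C suc w)) (+ (n C w)) ⟩
    + (n C w) + + (n C suc w) ≡⟨ pos-+ (n C w) (n C suc w) ⟨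
    + (n C w ℕ.+ n C suc w) ≡⟨ cong +_ (nCk+nC[k+1]≡[n+1]C[k+1] n w) ⟩
    + (suc n C suc w) ∎

module Walsh where

  open import Data.Bool using (Bool; true; false; _∧_; not; _xor_)
  open import Data.Bool.Properties using (∧-comm)
  open import Data.Nat using (suc)
  import Data.Nat.Properties as ℕ
  open import Data.Nat.Divisibility using (_∣_; divides)
  open import Data.Integer using (ℤ; +_; 1ℤ; -1ℤ; _+_; _*_; _^_)
  open import Data.Integer.Properties
  open import Algebra.Properties.CommutativeSemigroup *-commutativeSemigroup
    using (x∙yz≈y∙xz; x∙yz≈z∙yx; x∙yz≈y∙zx) renaming (interchange to *-interchange)
  open import Data.Integer.Tactic.RingSolver using (solve-∀)
  open import Data.Vec using ([]; _∷_)
  open import Data.Fin.Subset using (Subset; _∩_; ∣_∣; ∁; ⊥; ⊤)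
  open import Data.Fin.Subset.Properties using (∩-identityˡ)
  open import Relation.Binary.PropositionalEquality
  open import Defs using (_△_)
  open ≡-Reasoning
  open IntegerFacts using (-1^-even)
  open CubeSum

  sign : Bool → ℤ
  sign true = -1ℤ
  sign false = 1ℤ

  walsh : ∀ {n} → Subset n → Subset n → ℤ
  walsh J x = -1ℤ ^ ∣ J ∩ x ∣

  walsh-∷ : ∀ {n} a b (J x : Subset n) → walsh (a ∷ J) (b ∷ x) ≡ sign (a ∧ b) * walsh J x
  walsh-∷ true true J x = refl
  walsh-∷ true false J x = sym (*-identityˡ _)
  walsh-∷ false true J x = sym (*-identityˡ _)
  walsh-∷ false false J x = sym (*-identityˡ _)

  walsh-comm : ∀ {n} (J x : Subset n) → walsh J x ≡ walsh x J
  walsh-comm [] [] = refl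
  walsh-comm (a ∷ J) (b ∷ x) = begin
    walsh (a ∷ J) (b ∷ x) ≡⟨ walsh-∷ a b J x ⟩
    sign (a ∧ b) * walsh J x ≡⟨ cong₂ (λ c w → sign c * w) (∧-comm a b) (walsh-comm J x) ⟩
    sign (b ∧ a) * walsh x J ≡⟨ walsh-∷ b a x J ⟨
    walsh (b ∷ x) (a ∷ J) ∎

  walsh-⊥ : ∀ {n} (x : Subset n) → walsh ⊥ x ≡ 1ℤ
  walsh-⊥ [] = refl
  walsh-⊥ (b ∷ x) = walsh-⊥ x

  private
    sign-xor : ∀ a b c → sign (a ∧ b) * sign (a ∧ c) ≡ sign (a ∧ (b xor c))
    sign-xor false b c = refl
    sign-xor true true true = refl
    sign-xor true true false = refl
    sign-xor true false true = refl
    sign-xor true false false = refl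

    sign-∁ : ∀ a b → sign (not a ∧ b) ≡ sign b * sign (a ∧ b)
    sign-∁ true true = refl
    sign-∁ true false = refl
    sign-∁ false true = refl
    sign-∁ false false = refl

  △-∷ : ∀ {n} b c (x y : Subset n) → (b ∷ x) △ (c ∷ y) ≡ (b xor c) ∷ (x △ y)
  △-∷ true true x y = refl
  △-∷ true false x y = refl
  △-∷ false true x y = refl
  △-∷ false false x y = refl

  walsh-△ : ∀ {n} (J x y : Subset n) → walsh J x * walsh J y ≡ walsh J (x △ y)
  walsh-△ [] [] [] = refl
  walsh-△ (a ∷ J) (b ∷ x) (c ∷ y) = begin
    walsh (a ∷ J) (b ∷ x) * walsh (a ∷ J) (c ∷ y) ≡⟨ cong₂ _*_ (walsh-∷ a b J x) (walsh-∷ a c J y) ⟩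
    (sign (a ∧ b) * walsh J x) * (sign (a ∧ c) * walsh J y) ≡⟨ *-interchange (sign (a ∧ b)) (walsh J x) _ _ ⟩
    (sign (a ∧ b) * sign (a ∧ c)) * (walsh J x * walsh J y) ≡⟨ cong₂ _*_ (sign-xor a b c) (walsh-△ J x y) ⟩
    sign (a ∧ (b xor c)) * walsh J (x △ y) ≡⟨ walsh-∷ a (b xor c) J (x △ y) ⟨
    walsh (a ∷ J) ((b xor c) ∷ (x △ y)) ≡⟨ cong (walsh (a ∷ J)) (△-∷ b c x y) ⟨
    walsh (a ∷ J) ((b ∷ x) △ (c ∷ y)) ∎

  walsh-∁ : ∀ {n} (J x : Subset n) → walsh (∁ J) x ≡ walsh ⊤ x * walsh J x
  walsh-∁ [] [] = refl
  walsh-∁ (a ∷ J) (b ∷ x) = begin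
    walsh (not a ∷ ∁ J) (b ∷ x) ≡⟨ walsh-∷ (not a) b (∁ J) x ⟩
    sign (not a ∧ b) * walsh (∁ J) x ≡⟨ cong₂ _*_ (sign-∁ a b) (walsh-∁ J x) ⟩
    (sign b * sign (a ∧ b)) * (walsh ⊤ x * walsh J x) ≡⟨ *-interchange (sign b) _ (walsh ⊤ x) _ ⟩
    (sign b * walsh ⊤ x) * (sign (a ∧ b) * walsh J x) ≡⟨ cong₂ _*_ (walsh-∷ true b ⊤ x) (walsh-∷ a b J x) ⟨
    walsh ⊤ (b ∷ x) * walsh (a ∷ J) (b ∷ x) ∎

  walsh-orthogonal : ∀ {n} (x y : Subset n) → ∑ (λ J → walsh J x * walsh J y) ≡ (+ 2) ^ n * δ x y
  walsh-orthogonal [] [] = refl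
  walsh-orthogonal {suc n} (b ∷ x) (c ∷ y) = begin
    ∑ (λ J → walsh (false ∷ J) (b ∷ x) * walsh (false ∷ J) (c ∷ y)) + ∑ (λ J → walsh (true ∷ J) (b ∷ x) * walsh (true ∷ J) (c ∷ y))
      ≡⟨ cong₂ _+_ (∑-cong {n} (λ J → cong₂ _*_ (walsh-∷ false b J x) (walsh-∷ false c J y)))
                   (∑-cong {n} (λ J → trans (cong₂ _*_ (walsh-∷ true b J x) (walsh-∷ true c J y)) (*-interchange (sign b) _ (sign c) _))) ⟩
    ∑ (λ J → (1ℤ * walsh J x) * (1ℤ * walsh J y)) + ∑ (λ J → (sign b * sign c) * (walsh J x * walsh J y))
      ≡⟨ cong₂ _+_ (∑-cong {n} (λ J → cong₂ _*_ (*-identityˡ (walsh J x)) (*-identityˡ (walsh J y)))) (∑-*ˡ {n} (sign b * sign c) _) ⟩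
    S + (sign b * sign c) * S ≡⟨ cong (λ s → s + (sign b * sign c) * s) (walsh-orthogonal x y) ⟩
    P + (sign b * sign c) * P ≡⟨ factor P (sign b * sign c) ⟩
    (1ℤ + sign b * sign c) * P ≡⟨ cong (_* P) (sign-δ₂ b c) ⟩
    (+ 2 * δ₂ b c) * ((+ 2) ^ n * δ x y) ≡⟨ *-interchange (+ 2) (δ₂ b c) ((+ 2) ^ n) (δ x y) ⟩
    (+ 2) ^ suc n * δ (b ∷ x) (c ∷ y) ∎
    where
    S = ∑ (λ J → walsh J x * walsh J y)
    P = (+ 2) ^ n * δ x y
    factor : ∀ p t → p + t * p ≡ (1ℤ + t) * p
    factor = solve-∀
    sign-δ₂ : ∀ b c → 1ℤ + sign b * sign c ≡ + 2 * δ₂ b c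
    sign-δ₂ true true = refl
    sign-δ₂ true false = refl
    sign-δ₂ false true = refl
    sign-δ₂ false false = refl

  walsh-⊤-even : ∀ {n} {x : Subset n} → 2 ∣ ∣ x ∣ → walsh ⊤ x ≡ 1ℤ
  walsh-⊤-even {x = x} (divides q |x|≡q*2) = begin
    -1ℤ ^ ∣ ⊤ ∩ x ∣ ≡⟨ cong (λ y → -1ℤ ^ ∣ y ∣) (∩-identityˡ x) ⟩
    -1ℤ ^ ∣ x ∣ ≡⟨ cong (-1ℤ ^_) (trans |x|≡q*2 (trans (ℕ.*-comm q 2) (cong (q ℕ.+_) (ℕ.+-identityʳ q)))) ⟩
    -1ℤ ^ (q ℕ.+ q) ≡⟨ -1^-even q ⟩
    1ℤ ∎

  fourier : ∀ {n} → (Subset n → ℤ) → Subset n → ℤ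
  fourier g J = ∑ (λ x → g x * walsh J x)

  fourier-inversion : ∀ {n} (g : Subset n → ℤ) (a : Subset n) → ∑ (λ J → fourier g J * walsh J a) ≡ (+ 2) ^ n * g a
  fourier-inversion {n} g a = begin
    ∑ (λ J → fourier g J * walsh J a) ≡⟨ ∑-cong {n} (λ J → ∑-*ʳ {n} (walsh J a) _) ⟨
    ∑ (λ J → ∑ (λ x → (g x * walsh J x) * walsh J a)) ≡⟨ ∑-swap {n} {n} _ ⟩
    ∑ (λ x → ∑ (λ J → (g x * walsh J x) * walsh J a)) ≡⟨ ∑-cong {n} (λ x → trans (∑-cong {n} (λ J → *-assoc (g x) _ _)) (∑-*ˡ {n} (g x) _)) ⟩
    ∑ (λ x → g x * ∑ (λ J → walsh J x * walsh J a)) ≡⟨ ∑-cong {n} (λ x → cong (g x *_) (walsh-orthogonal x a)) ⟩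
    ∑ (λ x → g x * ((+ 2) ^ n * δ x a)) ≡⟨ ∑-cong {n} (λ x → x∙yz≈z∙yx (g x) ((+ 2) ^ n) (δ x a)) ⟩
    ∑ (λ x → δ x a * ((+ 2) ^ n * g x)) ≡⟨ ∑-δ a _ ⟩
    (+ 2) ^ n * g a ∎

  parseval : ∀ {n} (f g : Subset n → ℤ) → ∑ (λ J → fourier f J * fourier g J) ≡ (+ 2) ^ n * ∑ (λ x → f x * g x)
  parseval {n} f g = begin
    ∑ (λ J → fourier f J * fourier g J) ≡⟨ ∑-cong {n} (λ J → ∑-*ˡ {n} (fourier f J) _) ⟨
    ∑ (λ J → ∑ (λ x → fourier f J * (g x * walsh J x))) ≡⟨ ∑-swap {n} {n} _ ⟩
    ∑ (λ x → ∑ (λ J → fourier f J * (g x * walsh J x)))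
      ≡⟨ ∑-cong {n} (λ x → trans (∑-cong {n} (λ J → x∙yz≈y∙xz (fourier f J) (g x) (walsh J x))) (∑-*ˡ {n} (g x) _)) ⟩
    ∑ (λ x → g x * ∑ (λ J → fourier f J * walsh J x)) ≡⟨ ∑-cong {n} (λ x → cong (g x *_) (fourier-inversion f x)) ⟩
    ∑ (λ x → g x * ((+ 2) ^ n * f x)) ≡⟨ ∑-cong {n} (λ x → x∙yz≈y∙zx (g x) ((+ 2) ^ n) (f x)) ⟩
    ∑ (λ x → (+ 2) ^ n * (f x * g x)) ≡⟨ ∑-*ˡ {n} ((+ 2) ^ n) _ ⟩
    (+ 2) ^ n * ∑ (λ x → f x * g x) ∎

  △-cancelʳ : ∀ {n} (x d : Subset n) → (x △ d) △ d ≡ x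
  △-cancelʳ [] [] = refl
  △-cancelʳ (true ∷ x) (true ∷ d) = cong (true ∷_) (△-cancelʳ x d)
  △-cancelʳ (true ∷ x) (false ∷ d) = cong (true ∷_) (△-cancelʳ x d)
  △-cancelʳ (false ∷ x) (true ∷ d) = cong (false ∷_) (△-cancelʳ x d)
  △-cancelʳ (false ∷ x) (false ∷ d) = cong (false ∷_) (△-cancelʳ x d)

  fourier-translate : ∀ {n} (g : Subset n → ℤ) (J d : Subset n) → fourier g J * walsh J d ≡ fourier (λ x → g (x △ d)) J
  fourier-translate {n} g J d = begin
    fourier g J * walsh J d ≡⟨ ∑-*ʳ {n} (walsh J d) _ ⟨
    ∑ (λ x → (g x * walsh J x) * walsh J d) ≡⟨ ∑-cong {n} (λ x → trans (*-assoc (g x) _ _) (cong (g x *_) (walsh-△ J x d))) ⟩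
    ∑ (λ x → g x * walsh J (x △ d)) ≡⟨ ∑-△ (λ x → g x * walsh J (x △ d)) d ⟨
    ∑ (λ x → g (x △ d) * walsh J ((x △ d) △ d)) ≡⟨ ∑-cong {n} (λ x → cong (λ y → g (x △ d) * walsh J y) (△-cancelʳ x d)) ⟩
    fourier (λ x → g (x △ d)) J ∎

  wiener-khinchin : ∀ {n} (a g : Subset n → ℤ) →
    ∑ (λ J → fourier a J * (fourier g J * fourier g J)) ≡ (+ 2) ^ n * ∑ (λ D → a D * ∑ (λ x → g (x △ D) * g x))
  wiener-khinchin {n} a g = begin
    ∑ (λ J → fourier a J * (fourier g J * fourier g J)) ≡⟨ ∑-cong {n} (λ J → ∑-*ʳ {n} _ _) ⟨
    ∑ (λ J → ∑ (λ D → (a D * walsh J D) * (fourier g J * fourier g J))) ≡⟨ ∑-swap {n} {n} _ ⟩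
    ∑ (λ D → ∑ (λ J → (a D * walsh J D) * (fourier g J * fourier g J)))
      ≡⟨ ∑-cong {n} (λ D → ∑-cong {n} (λ J → regroup (a D) (walsh J D) (fourier g J))) ⟩
    ∑ (λ D → ∑ (λ J → a D * ((fourier g J * walsh J D) * fourier g J)))
      ≡⟨ ∑-cong {n} (λ D → trans (∑-cong {n} (λ J → cong (λ y → a D * (y * fourier g J)) (fourier-translate g J D))) (∑-*ˡ {n} (a D) _)) ⟩
    ∑ (λ D → a D * ∑ (λ J → fourier (λ x → g (x △ D)) J * fourier g J))
      ≡⟨ ∑-cong {n} (λ D → cong (a D *_) (parseval (λ x → g (x △ D)) g)) ⟩
    ∑ (λ D → a D * ((+ 2) ^ n * ∑ (λ x → g (x △ D) * g x)))
      ≡⟨ ∑-cong {n} (λ D → x∙yz≈y∙xz (a D) ((+ 2) ^ n) _) ⟩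
    ∑ (λ D → (+ 2) ^ n * (a D * ∑ (λ x → g (x △ D) * g x))) ≡⟨ ∑-*ˡ {n} ((+ 2) ^ n) _ ⟩
    (+ 2) ^ n * ∑ (λ D → a D * ∑ (λ x → g (x △ D) * g x)) ∎
    where
    regroup : ∀ p q r → (p * q) * (r * r) ≡ p * ((r * q) * r)
    regroup = solve-∀

  fourier-⊥ : ∀ {n} (g : Subset n → ℤ) → fourier g ⊥ ≡ ∑ g
  fourier-⊥ {n} g = ∑-cong {n} (λ x → trans (cong (g x *_) (walsh-⊥ x)) (*-identityʳ _))

  module EvenSupport {n} (g : Subset n → ℤ) (even-support : ∀ x → g x * walsh ⊤ x ≡ g x) where

    fourier-⊤ : fourier g ⊤ ≡ ∑ g
    fourier-⊤ = ∑-cong {n} even-support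

    fourier-∁ : ∀ J → fourier g (∁ J) ≡ fourier g J
    fourier-∁ J = ∑-cong {n} (λ x → begin
      g x * walsh (∁ J) x ≡⟨ cong (g x *_) (walsh-∁ J x) ⟩
      g x * (walsh ⊤ x * walsh J x) ≡⟨ *-assoc (g x) _ _ ⟨
      (g x * walsh ⊤ x) * walsh J x ≡⟨ cong (_* walsh J x) (even-support x) ⟩
      g x * walsh J x ∎)

module Krawtchouk where

  open import Data.Bool using (true; false; _∧_)
  open import Data.Nat using (ℕ; zero; suc; _∸_)
  open import Data.Nat.Properties using (+-suc)
  open import Data.Nat.Combinatorics using (_C_; nCk+nC[k+1]≡[n+1]C[k+1])
  open import Data.Integer using (ℤ; +_; 0ℤ; 1ℤ; -1ℤ; _+_; _*_; _-_; -_; _^_)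
  open import Data.Integer.Properties
  open import Algebra.Properties.CommutativeSemigroup *-commutativeSemigroup using (x∙yz≈y∙xz)
  open import Data.Integer.Tactic.RingSolver using (solve-∀)
  open import Data.Vec using ([]; _∷_)
  open import Data.Fin.Subset using (Subset; ∣_∣; ∁)
  open import Data.Fin.Subset.Properties using (∣∁p∣≡n∸∣p∣)
  open import Relation.Binary.PropositionalEquality
  open ≡-Reasoning
  open CubeSum
  open HammingLevels
  open Walsh

  -- Polynomials as coefficient sequences: mul1+sz s p is (1 + s z)·p, walshPoly J is ∏ᵢ (1 ± z) with
  -- the sign − exactly at i ∈ J, and krawtchouk u v is (1 − z)ᵘ(1 + z)ᵛ, whose z^k-coefficient is the
  -- Krawtchouk value K_k(u) in dimension u + v.
  Poly : Set
  Poly = ℕ → ℤ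

  _≐_ : Poly → Poly → Set
  p ≐ q = ∀ k → p k ≡ q k

  one : Poly
  one zero = 1ℤ
  one (suc k) = 0ℤ

  mul1+sz : ℤ → Poly → Poly
  mul1+sz s p zero = p zero
  mul1+sz s p (suc k) = p (suc k) + s * p k

  mul1+sz-cong : ∀ s {p q} → p ≐ q → mul1+sz s p ≐ mul1+sz s q
  mul1+sz-cong s p≐q zero = p≐q zero
  mul1+sz-cong s p≐q (suc k) = cong₂ (λ u v → u + s * v) (p≐q (suc k)) (p≐q k)

  mul1+sz-comm : ∀ s t p → mul1+sz s (mul1+sz t p) ≐ mul1+sz t (mul1+sz s p)
  mul1+sz-comm s t p zero = refl
  mul1+sz-comm s t p (suc zero) = exchange₁ (p 1) (p 0) s t
    where
    exchange₁ : ∀ a b s t → (a + t * b) + s * b ≡ (a + s * b) + t * b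
    exchange₁ = solve-∀
  mul1+sz-comm s t p (suc (suc k)) = exchange₂ (p (suc (suc k))) (p (suc k)) (p k) s t
    where
    exchange₂ : ∀ a b c s t → (a + t * b) + s * (b + t * c) ≡ (a + s * b) + t * (b + s * c)
    exchange₂ = solve-∀

  [1-z][1+z]-at-1 : ∀ p → mul1+sz -1ℤ (mul1+sz 1ℤ p) 1 ≡ p 1
  [1-z][1+z]-at-1 p = cancel (p 1) (p 0)
    where
    cancel : ∀ a b → (a + 1ℤ * b) + -1ℤ * b ≡ a
    cancel = solve-∀

  [1-z][1+z]-at-2+ : ∀ p k → mul1+sz -1ℤ (mul1+sz 1ℤ p) (suc (suc k)) ≡ p (suc (suc k)) - p k
  [1-z][1+z]-at-2+ p k = difference (p (suc (suc k))) (p (suc k)) (p k)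
    where
    difference : ∀ a b c → (a + 1ℤ * b) + -1ℤ * (b + 1ℤ * c) ≡ a - c
    difference = solve-∀

  walshPoly : ∀ {n} → Subset n → Poly
  walshPoly [] = one
  walshPoly (a ∷ J) = mul1+sz (sign a) (walshPoly J)

  levelSum : ∀ {n} → ℕ → Subset n → ℤ
  levelSum k J = ∑ (λ D → 𝟙[ ∣ D ∣ ≡ k ] * walsh J D)

  levelSum≡walshPoly : ∀ {n} k (J : Subset n) → levelSum k J ≡ walshPoly J k
  levelSum≡walshPoly zero [] = refl
  levelSum≡walshPoly (suc k) [] = refl
  levelSum≡walshPoly {suc n} k (a ∷ J) = begin
    ∑ (λ D → 𝟙[ ∣ D ∣ ≡ k ] * walsh (a ∷ J) (false ∷ D)) + ∑ (λ D → 𝟙[ suc ∣ D ∣ ≡ k ] * walsh (a ∷ J) (true ∷ D))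
      ≡⟨ cong₂ _+_ (∑-cong {n} (λ D → cong (𝟙[ ∣ D ∣ ≡ k ] *_) (trans (walsh-∷ a false J D) (cong (_* walsh J D) (sign-∧false a)))))
                   (∑-cong {n} (λ D → cong (𝟙[ suc ∣ D ∣ ≡ k ] *_) (trans (walsh-∷ a true J D) (cong (_* walsh J D) (sign-∧true a))))) ⟩
    ∑ (λ D → 𝟙[ ∣ D ∣ ≡ k ] * (1ℤ * walsh J D)) + ∑ (λ D → 𝟙[ suc ∣ D ∣ ≡ k ] * (sign a * walsh J D))
      ≡⟨ cong₂ _+_ (∑-cong {n} (λ D → cong (𝟙[ ∣ D ∣ ≡ k ] *_) (*-identityˡ (walsh J D)))) (upper k) ⟩
    levelSum k J + shifted k ≡⟨ cong (_+ shifted k) (levelSum≡walshPoly k J) ⟩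
    walshPoly J k + shifted k ≡⟨ lower k ⟩
    mul1+sz (sign a) (walshPoly J) k ∎
    where
    sign-∧false : ∀ a → sign (a ∧ false) ≡ 1ℤ
    sign-∧false true = refl
    sign-∧false false = refl
    sign-∧true : ∀ a → sign (a ∧ true) ≡ sign a
    sign-∧true true = refl
    sign-∧true false = refl
    shifted : ℕ → ℤ
    shifted zero = 0ℤ
    shifted (suc k) = sign a * walshPoly J k
    upper : ∀ k → ∑ (λ D → 𝟙[ suc ∣ D ∣ ≡ k ] * (sign a * walsh J D)) ≡ shifted k
    upper zero = trans (∑-cong {n} (λ D → *-zeroˡ (sign a * walsh J D))) (∑-0 {n})
    upper (suc k) = begin
      ∑ (λ D → 𝟙[ ∣ D ∣ ≡ k ] * (sign a * walsh J D)) ≡⟨ ∑-cong {n} (λ D → x∙yz≈y∙xz (𝟙[ ∣ D ∣ ≡ k ]) (sign a) (walsh J D)) ⟩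
      ∑ (λ D → sign a * (𝟙[ ∣ D ∣ ≡ k ] * walsh J D)) ≡⟨ ∑-*ˡ {n} (sign a) _ ⟩
      sign a * levelSum k J ≡⟨ cong (sign a *_) (levelSum≡walshPoly k J) ⟩
      sign a * walshPoly J k ∎
    lower : ∀ k → walshPoly J k + shifted k ≡ mul1+sz (sign a) (walshPoly J) k
    lower zero = +-identityʳ _
    lower (suc k) = refl

  krawtchouk : ℕ → ℕ → Poly
  krawtchouk zero zero = one
  krawtchouk (suc u) v = mul1+sz -1ℤ (krawtchouk u v)
  krawtchouk zero (suc v) = mul1+sz 1ℤ (krawtchouk zero v)

  krawtchouk-sucʳ : ∀ u v → krawtchouk u (suc v) ≐ mul1+sz 1ℤ (krawtchouk u v)
  krawtchouk-sucʳ zero v k = refl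
  krawtchouk-sucʳ (suc u) v k = trans (mul1+sz-cong -1ℤ (krawtchouk-sucʳ u v) k) (mul1+sz-comm -1ℤ 1ℤ (krawtchouk u v) k)

  walshPoly≐krawtchouk : ∀ {n} (J : Subset n) → walshPoly J ≐ krawtchouk ∣ J ∣ (∣ ∁ J ∣)
  walshPoly≐krawtchouk [] k = refl
  walshPoly≐krawtchouk (true ∷ J) k = mul1+sz-cong -1ℤ (walshPoly≐krawtchouk J) k
  walshPoly≐krawtchouk (false ∷ J) k = trans (mul1+sz-cong 1ℤ (walshPoly≐krawtchouk J) k) (sym (krawtchouk-sucʳ ∣ J ∣ (∣ ∁ J ∣) k))

  levelSum≡krawtchouk : ∀ {n} k (J : Subset n) → levelSum k J ≡ krawtchouk ∣ J ∣ (n ∸ ∣ J ∣) k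
  levelSum≡krawtchouk k J =
    trans (levelSum≡walshPoly k J) (trans (walshPoly≐krawtchouk J k) (cong (λ v → krawtchouk ∣ J ∣ v k) (∣∁p∣≡n∸∣p∣ J)))

  krawtchouk-reciprocity : ∀ n k w → + (n C w) * krawtchouk w (n ∸ w) k ≡ + (n C k) * krawtchouk k (n ∸ k) w
  krawtchouk-reciprocity n k w = begin
    + (n C w) * krawtchouk w (n ∸ w) k ≡⟨ weighted-count w k ⟨
    ∑ {n} (λ J → 𝟙[ ∣ J ∣ ≡ w ] * levelSum k J)
      ≡⟨ ∑-cong {n} (λ J → ∑-*ˡ {n} 𝟙[ ∣ J ∣ ≡ w ] _) ⟨
    ∑ {n} (λ J → ∑ {n} (λ D → 𝟙[ ∣ J ∣ ≡ w ] * (𝟙[ ∣ D ∣ ≡ k ] * walsh J D)))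
      ≡⟨ ∑-swap {n} {n} _ ⟩
    ∑ {n} (λ D → ∑ {n} (λ J → 𝟙[ ∣ J ∣ ≡ w ] * (𝟙[ ∣ D ∣ ≡ k ] * walsh J D)))
      ≡⟨ ∑-cong {n} (λ D → ∑-cong {n} (λ J → trans (x∙yz≈y∙xz 𝟙[ ∣ J ∣ ≡ w ] 𝟙[ ∣ D ∣ ≡ k ] (walsh J D))
                                                  (cong (λ c → 𝟙[ ∣ D ∣ ≡ k ] * (𝟙[ ∣ J ∣ ≡ w ] * c)) (walsh-comm J D)))) ⟩
    ∑ {n} (λ D → ∑ {n} (λ J → 𝟙[ ∣ D ∣ ≡ k ] * (𝟙[ ∣ J ∣ ≡ w ] * walsh D J)))
      ≡⟨ ∑-cong {n} (λ D → ∑-*ˡ {n} 𝟙[ ∣ D ∣ ≡ k ] _) ⟩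
    ∑ {n} (λ D → 𝟙[ ∣ D ∣ ≡ k ] * levelSum w D) ≡⟨ weighted-count k w ⟩
    + (n C k) * krawtchouk k (n ∸ k) w ∎
    where
    weighted-count : ∀ w k → ∑ {n} (λ J → 𝟙[ ∣ J ∣ ≡ w ] * levelSum k J) ≡ + (n C w) * krawtchouk w (n ∸ w) k
    weighted-count w k = begin
      ∑ {n} (λ J → 𝟙[ ∣ J ∣ ≡ w ] * levelSum k J)
        ≡⟨ ∑-cong {n} (λ J → trans (cong (𝟙[ ∣ J ∣ ≡ w ] *_) (levelSum≡krawtchouk k J)) (𝟙-subst ∣ J ∣ w (λ u → krawtchouk u (n ∸ u) k))) ⟩
      ∑ {n} (λ J → 𝟙[ ∣ J ∣ ≡ w ] * krawtchouk w (n ∸ w) k) ≡⟨ ∑-*ʳ {n} _ _ ⟩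
      ∑ {n} (λ J → 𝟙[ ∣ J ∣ ≡ w ]) * krawtchouk w (n ∸ w) k ≡⟨ cong (_* krawtchouk w (n ∸ w) k) (level-count n w) ⟩
      + (n C w) * krawtchouk w (n ∸ w) k ∎

  krawtchouk-diag-suc : ∀ m → krawtchouk (suc m) (suc m) ≐ mul1+sz -1ℤ (mul1+sz 1ℤ (krawtchouk m m))
  krawtchouk-diag-suc m = mul1+sz-cong -1ℤ (krawtchouk-sucʳ m m)

  krawtchouk-diag-even : ∀ m j → krawtchouk m m (j ℕ.+ j) ≡ -1ℤ ^ j * + (m C j)
  krawtchouk-diag-even zero zero = refl
  krawtchouk-diag-even zero (suc j) = trans (cong one (+-suc (suc j) j)) (sym (*-zeroʳ (-1ℤ ^ suc j)))
  krawtchouk-diag-even (suc m) zero = trans (krawtchouk-diag-suc m 0) (krawtchouk-diag-even m 0)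
  krawtchouk-diag-even (suc m) (suc j) = begin
    krawtchouk (suc m) (suc m) (suc j ℕ.+ suc j) ≡⟨ cong (krawtchouk (suc m) (suc m)) 2+2j ⟩
    krawtchouk (suc m) (suc m) (suc (suc (j ℕ.+ j))) ≡⟨ krawtchouk-diag-suc m (suc (suc (j ℕ.+ j))) ⟩
    mul1+sz -1ℤ (mul1+sz 1ℤ (krawtchouk m m)) (suc (suc (j ℕ.+ j))) ≡⟨ [1-z][1+z]-at-2+ (krawtchouk m m) (j ℕ.+ j) ⟩
    krawtchouk m m (suc (suc (j ℕ.+ j))) - krawtchouk m m (j ℕ.+ j)
      ≡⟨ cong₂ _-_ (trans (cong (krawtchouk m m) (sym 2+2j)) (krawtchouk-diag-even m (suc j))) (krawtchouk-diag-even m j) ⟩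
    -1ℤ * -1ℤ ^ j * + (m C suc j) - -1ℤ ^ j * + (m C j) ≡⟨ alternate (-1ℤ ^ j) (+ (m C suc j)) (+ (m C j)) ⟩
    -1ℤ ^ suc j * (+ (m C j) + + (m C suc j)) ≡⟨ cong (-1ℤ ^ suc j *_) (pos-+ (m C j) (m C suc j)) ⟨
    -1ℤ ^ suc j * + (m C j ℕ.+ m C suc j) ≡⟨ cong (λ c → -1ℤ ^ suc j * + c) (nCk+nC[k+1]≡[n+1]C[k+1] m j) ⟩
    -1ℤ ^ suc j * + (suc m C suc j) ∎
    where
    2+2j : suc j ℕ.+ suc j ≡ suc (suc (j ℕ.+ j))
    2+2j = cong suc (+-suc j j)
    alternate : ∀ s a b → -1ℤ * s * a - s * b ≡ -1ℤ * s * (b + a)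
    alternate = solve-∀

  krawtchouk-diag-odd : ∀ m j → krawtchouk m m (suc (j ℕ.+ j)) ≡ 0ℤ
  krawtchouk-diag-odd zero j = refl
  krawtchouk-diag-odd (suc m) zero = trans (krawtchouk-diag-suc m 1) (trans ([1-z][1+z]-at-1 (krawtchouk m m)) (krawtchouk-diag-odd m 0))
  krawtchouk-diag-odd (suc m) (suc j) = begin
    krawtchouk (suc m) (suc m) (suc (suc j ℕ.+ suc j)) ≡⟨ cong (λ i → krawtchouk (suc m) (suc m) (suc i)) 2+2j ⟩
    krawtchouk (suc m) (suc m) (suc (suc (suc (j ℕ.+ j)))) ≡⟨ krawtchouk-diag-suc m (suc (suc (suc (j ℕ.+ j)))) ⟩
    mul1+sz -1ℤ (mul1+sz 1ℤ (krawtchouk m m)) (suc (suc (suc (j ℕ.+ j)))) ≡⟨ [1-z][1+z]-at-2+ (krawtchouk m m) (suc (j ℕ.+ j)) ⟩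
    krawtchouk m m (suc (suc (suc (j ℕ.+ j)))) - krawtchouk m m (suc (j ℕ.+ j))
      ≡⟨ cong₂ _-_ (trans (cong (λ i → krawtchouk m m (suc i)) (sym 2+2j)) (krawtchouk-diag-odd m (suc j))) (krawtchouk-diag-odd m j) ⟩
    0ℤ ∎
    where
    2+2j : suc j ℕ.+ suc j ≡ suc (suc (j ℕ.+ j))
    2+2j = cong suc (+-suc j j)

module Binomial where

  open import Data.Nat
  open import Data.Nat.Properties
  open import Data.Nat.Combinatorics using (_C_; nCk+nC[k+1]≡[n+1]C[k+1]; nCk≡nC[n∸k]; nC1≡n; k>n⇒nCk≡0)
  open import Algebra.Properties.CommutativeSemigroup *-commutativeSemigroup using (x∙yz≈y∙xz)
  open import Algebra.Properties.CommutativeSemigroup +-commutativeSemigroup using () renaming (interchange to +-interchange)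
  open import Data.Nat.Tactic.RingSolver using (solve-∀)
  open import Data.Product using (_×_; _,_; map; map₂)
  open import Function using (_∘_)
  open import Data.Sum using (_⊎_; inj₁; inj₂)
  open import Relation.Binary.PropositionalEquality
  open import Relation.Nullary using (contradiction; yes; no)

  pascal : ∀ n k → suc n C suc k ≡ n C k + n C suc k
  pascal n k = sym (nCk+nC[k+1]≡[n+1]C[k+1] n k)

  C-pos : ∀ {n k} → k ≤ n → 0 < n C k
  C-pos {n} {zero} _ = s≤s z≤n
  C-pos {suc n} {suc k} (s≤s k≤n) = <-≤-trans (C-pos k≤n) (≤-trans (m≤m+n _ _) (≤-reflexive (sym (pascal n k))))

  C-sym : ∀ a b → (a + b) C a ≡ (a + b) C b
  C-sym a b = trans (nCk≡nC[n∸k] (m≤m+n a b)) (cong ((a + b) C_) (m+n∸m≡n a b))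

  C-absorb : ∀ n k → suc k * (suc n C suc k) ≡ suc n * (n C k)
  C-absorb zero zero = refl
  C-absorb zero (suc k) = trans (cong (suc (suc k) *_) (k>n⇒nCk≡0 {1} {suc (suc k)} (s≤s (s≤s z≤n)))) (*-zeroʳ (suc (suc k)))
  C-absorb (suc n) zero = trans (+-identityʳ _) (trans (nC1≡n (suc (suc n))) (sym (*-identityʳ (suc (suc n)))))
  C-absorb (suc n) (suc k) = begin
    suc (suc k) * (suc (suc n) C suc (suc k)) ≡⟨ cong (suc (suc k) *_) (pascal (suc n) (suc k)) ⟩
    suc (suc k) * (a + b) ≡⟨ expand k a b ⟩
    a + (suc k * a + suc (suc k) * b) ≡⟨ cong (λ x → a + x) (cong₂ _+_ (C-absorb n k) (C-absorb n (suc k))) ⟩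
    a + (suc n * (n C k) + suc n * (n C suc k)) ≡⟨ cong (a +_) (*-distribˡ-+ (suc n) (n C k) (n C suc k)) ⟨
    a + suc n * (n C k + n C suc k) ≡⟨ cong (λ x → a + suc n * x) (pascal n k) ⟨
    suc (suc n) * a ∎
    where
    open ≡-Reasoning
    a = suc n C suc k
    b = suc n C suc (suc k)
    expand : ∀ k a b → suc (suc k) * (a + b) ≡ a + (suc k * a + suc (suc k) * b)
    expand = solve-∀

  C-ratio : ∀ {N a p} → N ≡ a + p → suc a * (N C suc a) ≡ p * (N C a)
  C-ratio {N} {a} {p} refl = +-cancelˡ-≡ (suc a * (N C a)) _ _ (begin
    suc a * (N C a) + suc a * (N C suc a) ≡⟨ *-distribˡ-+ (suc a) (N C a) _ ⟨
    suc a * (N C a + N C suc a) ≡⟨ cong (suc a *_) (pascal N a) ⟨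
    suc a * (suc N C suc a) ≡⟨ C-absorb N a ⟩
    (suc a + p) * (N C a) ≡⟨ *-distribʳ-+ (N C a) (suc a) p ⟩
    suc a * (N C a) + p * (N C a) ∎)
    where open ≡-Reasoning

  -- Passing from j to j + 1 multiplies C(2m,2j)/C(m,j) by (2m − 2j − 1)/(2j + 1), with q = 2m − 2j − 1.
  double-binomial-step : ∀ {M j p q a a′ b b′ b″} → p + p ≡ suc q →
    suc j * a′ ≡ p * a → suc (j + j) * b′ ≡ suc q * b → suc (suc (j + j)) * b″ ≡ q * b′ →
    suc (j + j) < q → 0 < b → M * a ≤ b → M * a′ < b″
  double-binomial-step {M} {j} {p} {q} {a} {a′} {b} {b′} {b″} 2p≡1+q a′≡ b′≡ b″≡ 2j+1<q b>0 Ma≤b =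
    *-cancelˡ-< K (M * a′) b″ (begin-strict
      K * (M * a′) ≡⟨ regroup₁ j M a′ ⟩
      suc (j + j) * M * (2 * (suc j * a′)) ≡⟨ cong (λ x → suc (j + j) * M * (2 * x)) a′≡ ⟩
      suc (j + j) * M * (2 * (p * a)) ≡⟨ regroup₂ j M p a ⟩
      (p + p) * (suc (j + j) * (M * a)) ≡⟨ cong (_* (suc (j + j) * (M * a))) 2p≡1+q ⟩
      suc q * (suc (j + j) * (M * a)) ≤⟨ *-monoʳ-≤ (suc q) (*-monoʳ-≤ (suc (j + j)) Ma≤b) ⟩
      suc q * (suc (j + j) * b) <⟨ *-monoʳ-< (suc q) (*-monoˡ-< b {{>-nonZero b>0}} 2j+1<q) ⟩
      suc q * (q * b) ≡⟨ x∙yz≈y∙xz (suc q) q b ⟩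
      q * (suc q * b) ≡⟨ cong (q *_) b′≡ ⟨
      q * (suc (j + j) * b′) ≡⟨ x∙yz≈y∙xz q (suc (j + j)) b′ ⟩
      suc (j + j) * (q * b′) ≡⟨ cong (suc (j + j) *_) b″≡ ⟨
      suc (j + j) * (suc (suc (j + j)) * b″) ≡⟨ *-assoc (suc (j + j)) (suc (suc (j + j))) b″ ⟨
      K * b″ ∎)
    where
    open ≤-Reasoning
    K = suc (j + j) * suc (suc (j + j))
    regroup₁ : ∀ j M a → suc (j + j) * suc (suc (j + j)) * (M * a) ≡ suc (j + j) * M * (2 * (suc j * a))
    regroup₁ = solve-∀
    regroup₂ : ∀ j M p a → suc (j + j) * M * (2 * (p * a)) ≡ (p + p) * (suc (j + j) * (M * a))
    regroup₂ = solve-∀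

  module DoubleBinomial {m n₁ : ℕ} (m+m≡1+n₁ : m + m ≡ suc n₁) where

    base : n₁ * (m C 1) ≡ (m + m) C 2
    base = *-cancelˡ-≡ (n₁ * (m C 1)) ((m + m) C 2) 2 (begin
      2 * (n₁ * (m C 1)) ≡⟨ cong (λ x → 2 * (n₁ * x)) (nC1≡n m) ⟩
      2 * (n₁ * m) ≡⟨ double n₁ m ⟩
      (m + m) * n₁ ≡⟨ cong (_* n₁) m+m≡1+n₁ ⟩
      suc n₁ * n₁ ≡⟨ cong (suc n₁ *_) (nC1≡n n₁) ⟨
      suc n₁ * (n₁ C 1) ≡⟨ C-absorb n₁ 1 ⟨
      2 * (suc n₁ C 2) ≡⟨ cong (λ x → 2 * (x C 2)) m+m≡1+n₁ ⟨
      2 * ((m + m) C 2) ∎)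
      where
      open ≡-Reasoning
      double : ∀ n m → 2 * (n * m) ≡ (m + m) * n
      double = solve-∀

    below-half-≤ : ∀ {i p} → m ≡ suc i + p → suc i ≤ p → n₁ * (m C suc i) ≤ (m + m) C (suc i + suc i)
    below-half-< : ∀ {i p} → m ≡ suc (suc i) + p → suc (suc i) ≤ p →
      n₁ * (m C suc (suc i)) < (m + m) C suc (suc (suc i + suc i))
    below-half-≤ {zero} _ _ = ≤-reflexive base
    below-half-≤ {suc i} m≡ 2+i≤p = subst (λ t → n₁ * (m C suc (suc i)) ≤ (m + m) C t) (sym (cong suc (+-suc (suc i) (suc i))))
      (<⇒≤ (below-half-< m≡ 2+i≤p))
    below-half-< {i} {p} m≡ 2+i≤p =
      double-binomial-step {M = n₁} {j = j} {p = suc p} {q = q} refl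
        (C-ratio {a = j} {p = suc p} m≡′) (C-ratio {a = j + j} {p = suc p + suc p} 2m≡2j+2p+2) (C-ratio {a = suc (j + j)} {p = q} 2m≡2j+1+q) 2j+1<q
        (C-pos (+-mono-≤ j≤m j≤m)) (below-half-≤ m≡′ (m≤n⇒m≤1+n (<⇒≤ 2+i≤p)))
      where
      j = suc i
      q = p + suc p
      m≡′ : m ≡ j + suc p
      m≡′ = trans m≡ (sym (+-suc j p))
      2m≡2j+2p+2 : m + m ≡ (j + j) + (suc p + suc p)
      2m≡2j+2p+2 = trans (cong₂ _+_ m≡′ m≡′) (+-interchange j (suc p) j (suc p))
      2m≡2j+1+q : m + m ≡ suc (j + j) + q
      2m≡2j+1+q = trans 2m≡2j+2p+2 (+-suc (j + j) q)
      j≤m : j ≤ m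
      j≤m = ≤-trans (m≤m+n j (suc p)) (≤-reflexive (sym m≡′))
      2j+1<q : suc (j + j) < q
      2j+1<q = ≤-trans (s≤s (+-mono-< 2+i≤p 2+i≤p)) (≤-reflexive (sym (+-suc p p)))

    below-half : ∀ {j p} → m ≡ j + p → 1 ≤ j → j ≤ p →
      n₁ * (m C j) ≤ (m + m) C (j + j) × (n₁ * (m C j) ≡ (m + m) C (j + j) → j ≡ 1)
    below-half {suc zero} _ _ _ = ≤-reflexive base , λ _ → refl
    below-half {suc (suc i)} m≡ _ j≤p = <⇒≤ strict , λ eq → contradiction eq (<⇒≢ strict)
      where
      strict : n₁ * (m C suc (suc i)) < (m + m) C (suc (suc i) + suc (suc i))
      strict = subst (λ t → n₁ * (m C suc (suc i)) < (m + m) C t) (sym (cong suc (+-suc (suc i) (suc i)))) (below-half-< m≡ j≤p)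

    double-binomial : ∀ {j p} → m ≡ j + p → 1 ≤ j → 1 ≤ p →
      n₁ * (m C j) ≤ (m + m) C (j + j) × (n₁ * (m C j) ≡ (m + m) C (j + j) → j ≡ 1 ⊎ p ≡ 1)
    double-binomial {j} {p} m≡j+p 1≤j 1≤p with j ≤? p
    ... | yes j≤p = map₂ (inj₁ ∘_) (below-half m≡j+p 1≤j j≤p)
    ... | no j≰p = map (subst₂ _≤_ (cong (n₁ *_) (sym mCj≡mCp)) (sym 2mC2j≡2mC2p))
                       (λ tight eq → inj₂ (tight (trans (cong (n₁ *_) (sym mCj≡mCp)) (trans eq 2mC2j≡2mC2p))))
                       (below-half (trans m≡j+p (+-comm j p)) 1≤p (<⇒≤ (≰⇒> j≰p)))
      where
      mCj≡mCp : m C j ≡ m C p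
      mCj≡mCp = subst (λ N → N C j ≡ N C p) (sym m≡j+p) (C-sym j p)
      2m≡2j+2p : m + m ≡ (j + j) + (p + p)
      2m≡2j+2p = trans (cong₂ _+_ m≡j+p m≡j+p) (+-interchange j p j p)
      2mC2j≡2mC2p : (m + m) C (j + j) ≡ (m + m) C (p + p)
      2mC2j≡2mC2p = subst (λ N → N C (j + j) ≡ N C (p + p)) (sym 2m≡2j+2p) (C-sym (j + j) (p + p))

module Eigenvalue {m n₁ : ℕ} (m+m≡1+n₁ : m ℕ.+ m ≡ ℕ.suc n₁) where

  open import Data.Nat using (zero; suc; _∸_; z≤n; s≤s)
  import Data.Nat.Properties as ℕ
  open import Data.Nat.Combinatorics using (_C_; nCn≡1)
  open import Data.Integer using (ℤ; +_; 0ℤ; 1ℤ; -1ℤ; _+_; _*_; _-_; -_; _^_; _≤_; _<_; +≤+; +<+)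
  open import Data.Integer.Properties
  open import Data.Integer.Tactic.RingSolver using (solve-∀)
  import Data.Nat.Tactic.RingSolver as NatSolver
  open import Function using (_∘_)
  open import Data.Product using (∃-syntax; _×_; _,_; proj₁; proj₂)
  open import Data.Sum using (_⊎_; inj₁; inj₂)
  open import Relation.Binary.PropositionalEquality
  open import Relation.Nullary using (contradiction)
  open ≡-Reasoning
  open IntegerFacts using (*-cancelˡ-≤-0<; -1^-even)
  open Krawtchouk
  open Binomial using (C-pos; module DoubleBinomial)
  open DoubleBinomial {m} m+m≡1+n₁ using (double-binomial)

  n : ℕ
  n = m ℕ.+ m

  krawtchouk-middle : ∀ w → + (n C w) * krawtchouk w (n ∸ w) m ≡ + (n C m) * krawtchouk m m w
  krawtchouk-middle w = trans (krawtchouk-reciprocity n m w) (cong (λ v → + (n C m) * krawtchouk m v w) (ℕ.m+n∸n≡m m m))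

  even-or-odd : ∀ w → ∃[ j ] (w ≡ j ℕ.+ j ⊎ w ≡ suc (j ℕ.+ j))
  even-or-odd zero = zero , inj₁ refl
  even-or-odd (suc w) with even-or-odd w
  ... | j , inj₁ w≡2j = j , inj₂ (cong suc w≡2j)
  ... | j , inj₂ w≡2j+1 = suc j , inj₁ (trans (cong suc w≡2j+1) (sym (ℕ.+-suc (suc j) j)))

  Tight : ℕ → Set
  Tight w = w ≡ 2 ⊎ 2 ℕ.+ w ≡ n

  NonnegTight : ℤ → ℕ → Set
  NonnegTight e w = 0ℤ ≤ e × (e ≡ 0ℤ → Tight w)

  positive⇒NonnegTight : ∀ {e w} → 0ℤ < e → NonnegTight e w
  positive⇒NonnegTight 0<e = <⇒≤ 0<e , λ e≡0 → contradiction (sym e≡0) (<⇒≢ 0<e)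

  dual : ℕ → ℤ
  dual w = + n₁ * krawtchouk m m w + + (n C w)

  dual-odd : ∀ j → dual (suc (j ℕ.+ j)) ≡ + (n C suc (j ℕ.+ j))
  dual-odd j = begin
    + n₁ * krawtchouk m m (suc (j ℕ.+ j)) + + (n C suc (j ℕ.+ j)) ≡⟨ cong (λ x → + n₁ * x + + (n C suc (j ℕ.+ j))) (krawtchouk-diag-odd m j) ⟩
    + n₁ * 0ℤ + + (n C suc (j ℕ.+ j)) ≡⟨ cong (_+ + (n C suc (j ℕ.+ j))) (*-zeroʳ (+ n₁)) ⟩
    0ℤ + + (n C suc (j ℕ.+ j)) ≡⟨ +-identityˡ _ ⟩
    + (n C suc (j ℕ.+ j)) ∎

  dual-4i : ∀ i → let j = i ℕ.+ i in dual (j ℕ.+ j) ≡ + (n₁ ℕ.* (m C j) ℕ.+ n C (j ℕ.+ j))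
  dual-4i i = begin
    + n₁ * krawtchouk m m (j ℕ.+ j) + + (n C (j ℕ.+ j)) ≡⟨ cong (λ x → + n₁ * x + + (n C (j ℕ.+ j))) (krawtchouk-diag-even m j) ⟩
    + n₁ * (-1ℤ ^ j * + (m C j)) + + (n C (j ℕ.+ j)) ≡⟨ cong (λ s → + n₁ * (s * + (m C j)) + + (n C (j ℕ.+ j))) (-1^-even i) ⟩
    + n₁ * (1ℤ * + (m C j)) + + (n C (j ℕ.+ j)) ≡⟨ cong (λ x → + n₁ * x + + (n C (j ℕ.+ j))) (*-identityˡ _) ⟩
    + n₁ * + (m C j) + + (n C (j ℕ.+ j)) ≡⟨ cong (_+ + (n C (j ℕ.+ j))) (pos-* n₁ (m C j)) ⟨
    + (n₁ ℕ.* (m C j)) + + (n C (j ℕ.+ j)) ≡⟨ pos-+ (n₁ ℕ.* (m C j)) (n C (j ℕ.+ j)) ⟨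
    + (n₁ ℕ.* (m C j) ℕ.+ n C (j ℕ.+ j)) ∎
    where j = i ℕ.+ i

  dual-4i+2 : ∀ i → let j = suc (i ℕ.+ i) in dual (j ℕ.+ j) ≡ + (n C (j ℕ.+ j)) - + (n₁ ℕ.* (m C j))
  dual-4i+2 i = begin
    + n₁ * krawtchouk m m (j ℕ.+ j) + + (n C (j ℕ.+ j)) ≡⟨ cong (λ x → + n₁ * x + + (n C (j ℕ.+ j))) (krawtchouk-diag-even m j) ⟩
    + n₁ * (-1ℤ * -1ℤ ^ (i ℕ.+ i) * + (m C j)) + + (n C (j ℕ.+ j)) ≡⟨ cong (λ s → + n₁ * (-1ℤ * s * + (m C j)) + + (n C (j ℕ.+ j))) (-1^-even i) ⟩
    + n₁ * (-1ℤ * 1ℤ * + (m C j)) + + (n C (j ℕ.+ j)) ≡⟨ negate (+ n₁) (+ (m C j)) (+ (n C (j ℕ.+ j))) ⟩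
    + (n C (j ℕ.+ j)) - + n₁ * + (m C j) ≡⟨ cong (λ x → + (n C (j ℕ.+ j)) - x) (pos-* n₁ (m C j)) ⟨
    + (n C (j ℕ.+ j)) - + (n₁ ℕ.* (m C j)) ∎
    where
    j = suc (i ℕ.+ i)
    negate : ∀ a b c → a * (-1ℤ * 1ℤ * b) + c ≡ c - a * b
    negate = solve-∀

  dual-nonneg : ∀ {w} → w ℕ.< n → NonnegTight (dual w) w
  dual-nonneg {w} w<n with even-or-odd w
  ... | j , inj₂ refl = positive⇒NonnegTight (subst (0ℤ <_) (sym (dual-odd j)) (+<+ (C-pos (ℕ.<⇒≤ w<n))))
  ... | j , inj₁ refl with even-or-odd j
  ...   | i , inj₁ refl = positive⇒NonnegTight (subst (0ℤ <_) (sym (dual-4i i))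
                            (+<+ (ℕ.<-≤-trans (C-pos (ℕ.<⇒≤ w<n)) (ℕ.m≤n+m _ _))))
  ...   | i , inj₂ refl = subst (λ e → NonnegTight e w) (sym (trans (dual-4i+2 i) c-a≡c∸a)) (+≤+ z≤n , tightness)
    where
    j<m : j ℕ.< m
    j<m = ℕ.≰⇒> (λ m≤j → ℕ.<⇒≱ w<n (ℕ.+-mono-≤ m≤j m≤j))
    p = m ∸ j
    m≡j+p : m ≡ j ℕ.+ p
    m≡j+p = sym (ℕ.m+[n∸m]≡n (ℕ.<⇒≤ j<m))
    bound-tight = double-binomial m≡j+p (s≤s z≤n) (ℕ.m<n⇒0<n∸m j<m)
    a = n₁ ℕ.* (m C j)
    c = n C (j ℕ.+ j)
    c-a≡c∸a : + c - + a ≡ + (c ∸ a)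
    c-a≡c∸a = trans (m-n≡m⊖n c a) (≤-⊖ (proj₁ bound-tight))
    tightness : + (c ∸ a) ≡ 0ℤ → Tight w
    tightness c∸a≡0 with proj₂ bound-tight (ℕ.≤-antisym (proj₁ bound-tight) (ℕ.m∸n≡0⇒m≤n (+-injective c∸a≡0)))
    ... | inj₁ j≡1 = inj₁ (cong (λ k → k ℕ.+ k) j≡1)
    ... | inj₂ p≡1 = inj₂ (trans (2+2j≡2[j+1] j) (cong (λ k → k ℕ.+ k) (sym (trans m≡j+p (cong (j ℕ.+_) p≡1)))))
      where
      2+2j≡2[j+1] : ∀ j → 2 ℕ.+ (j ℕ.+ j) ≡ (j ℕ.+ 1) ℕ.+ (j ℕ.+ 1)
      2+2j≡2[j+1] = NatSolver.solve-∀

  -- eigen w is the eigenvalue of (n − 1)·A + C(n,m)·I on the weight-w characters, A the distance-m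
  -- adjacency matrix of the cube; dual w is the same quantity with the roles of w and m exchanged.
  eigen : ℕ → ℤ
  eigen w = + n₁ * krawtchouk w (n ∸ w) m + + (n C m)

  binomial-eigen≡dual : ∀ w → + (n C w) * eigen w ≡ + (n C m) * dual w
  binomial-eigen≡dual w = begin
    c * (+ n₁ * krawtchouk w (n ∸ w) m + k) ≡⟨ distribute c (+ n₁) (krawtchouk w (n ∸ w) m) k ⟩
    + n₁ * (c * krawtchouk w (n ∸ w) m) + c * k ≡⟨ cong (λ x → + n₁ * x + c * k) (krawtchouk-middle w) ⟩
    + n₁ * (k * krawtchouk m m w) + c * k ≡⟨ collect c (+ n₁) (krawtchouk m m w) k ⟩
    k * (+ n₁ * krawtchouk m m w + c) ∎
    where
    c = + (n C w)
    k = + (n C m)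
    distribute : ∀ c n a k → c * (n * a + k) ≡ n * (c * a) + c * k
    distribute = solve-∀
    collect : ∀ c n g k → n * (k * g) + c * k ≡ k * (n * g + c)
    collect = solve-∀

  eigen-nonneg : ∀ {w} → w ℕ.< n → NonnegTight (eigen w) w
  eigen-nonneg {w} w<n with dual-nonneg w<n
  ... | dual≥0 , dual-tight = eigen≥0 , dual-tight ∘ dual≡0
    where
    c>0 : 0ℤ < + (n C w)
    c>0 = +<+ (C-pos (ℕ.<⇒≤ w<n))
    k>0 : 0ℤ < + (n C m)
    k>0 = +<+ (C-pos (ℕ.m≤m+n m m))
    eigen≥0 : 0ℤ ≤ eigen w
    eigen≥0 = *-cancelˡ-≤-0< c>0
      (subst₂ _≤_ (trans (*-zeroʳ (+ (n C m))) (sym (*-zeroʳ (+ (n C w))))) (sym (binomial-eigen≡dual w))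
        (*-monoˡ-≤-nonNeg (+ (n C m)) dual≥0))
    dual≡0 : eigen w ≡ 0ℤ → dual w ≡ 0ℤ
    dual≡0 eigen≡0 with i*j≡0⇒i≡0∨j≡0 (+ (n C m)) (trans (sym (binomial-eigen≡dual w)) (trans (cong (+ (n C w) *_) eigen≡0) (*-zeroʳ (+ (n C w)))))
    ... | inj₁ k≡0 = contradiction (sym k≡0) (<⇒≢ k>0)
    ... | inj₂ dual≡0 = dual≡0

  krawtchouk-at-0 : krawtchouk 0 (n ∸ 0) m ≡ + (n C m)
  krawtchouk-at-0 = begin
    krawtchouk 0 (n ∸ 0) m ≡⟨ *-identityˡ _ ⟨
    + (n C 0) * krawtchouk 0 (n ∸ 0) m ≡⟨ krawtchouk-middle 0 ⟩
    + (n C m) * krawtchouk m m 0 ≡⟨ cong (+ (n C m) *_) (krawtchouk-diag-even m 0) ⟩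
    + (n C m) * 1ℤ ≡⟨ *-identityʳ _ ⟩
    + (n C m) ∎

  krawtchouk-at-n : ∀ {h} → m ≡ h ℕ.+ h → krawtchouk n (n ∸ n) m ≡ + (n C m)
  krawtchouk-at-n {h} m≡2h = begin
    krawtchouk n (n ∸ n) m ≡⟨ *-identityˡ _ ⟨
    + 1 * krawtchouk n (n ∸ n) m ≡⟨ cong (λ x → + x * krawtchouk n (n ∸ n) m) (nCn≡1 n) ⟨
    + (n C n) * krawtchouk n (n ∸ n) m ≡⟨ krawtchouk-middle n ⟩
    + (n C m) * krawtchouk m m (m ℕ.+ m) ≡⟨ cong (+ (n C m) *_) (krawtchouk-diag-even m m) ⟩
    + (n C m) * (-1ℤ ^ m * + (m C m)) ≡⟨ cong₂ (λ s x → + (n C m) * (s * + x)) (trans (cong (-1ℤ ^_) m≡2h) (-1^-even h)) (nCn≡1 m) ⟩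
    + (n C m) * 1ℤ ≡⟨ *-identityʳ _ ⟩
    + (n C m) ∎

module RatioBound {m h : ℕ} (m≡h+h : m ≡ h ℕ.+ h) (0<h : 0 ℕ.< h) where

  open import Data.Nat using (suc; _∸_; z≤n; s≤s)
  import Data.Nat.Properties as ℕ
  open import Data.Nat.Combinatorics using (_C_)
  open import Data.Integer using (ℤ; +_; 0ℤ; 1ℤ; _+_; _*_; _-_; -_; _^_; _≤_; _<_; +≤+; +<+; _≟_)
  open import Data.Integer.Properties
  open import Data.Integer.Tactic.RingSolver using (solve-∀)
  open import Data.Product using (_×_; _,_; proj₁; proj₂)
  open import Data.Sum using (_⊎_; inj₁; inj₂)
  import Data.Sum as Sum
  open import Data.Fin.Subset using (Subset; ∣_∣; ∁; ⊥; ⊤)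
  open import Data.Fin.Subset.Properties using (∣p∣≤n)
  open import Function using (_∘_)
  open import Relation.Binary.PropositionalEquality
  open import Relation.Nullary using (yes; no)
  open ≡-Reasoning
  open import Defs using (_△_)
  open CubeSum
  open HammingLevels
  open Walsh
  open Krawtchouk
  open IntegerFacts

  n : ℕ
  n = m ℕ.+ m

  4≤n : 4 ℕ.≤ n
  4≤n = subst (4 ℕ.≤_) (cong (λ x → x ℕ.+ x) (sym m≡h+h)) (ℕ.+-mono-≤ 2≤h+h 2≤h+h)
    where
    2≤h+h : 2 ℕ.≤ h ℕ.+ h
    2≤h+h = ℕ.+-mono-≤ 0<h 0<h

  n>0 : 0 ℕ.< n
  n>0 = ℕ.<-≤-trans (s≤s z≤n) 4≤n

  2<n : 2 ℕ.< n
  2<n = ℕ.<-≤-trans (s≤s (s≤s (s≤s z≤n))) 4≤n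

  n∸2>0 : 0 ℕ.< n ∸ 2
  n∸2>0 = ℕ.m<n⇒0<n∸m 2<n

  n∸2<n : n ∸ 2 ℕ.< n
  n∸2<n = ℕ.∸-monoʳ-< (s≤s z≤n) (ℕ.<⇒≤ 2<n)

  n₁ : ℕ
  n₁ = ℕ.pred n

  n≡1+n₁ : n ≡ suc n₁
  n≡1+n₁ = sym (ℕ.suc-pred n {{ℕ.>-nonZero n>0}})

  open Eigenvalue {m} {n₁} n≡1+n₁ using (eigen; eigen-nonneg; krawtchouk-at-0; krawtchouk-at-n; Tight)

  k : ℤ
  k = + (n C m)

  Support : ℕ → Set
  Support w = w ≡ 0 ⊎ w ≡ n ⊎ Tight w

  weight : ℕ → ℤ
  weight w = eigen w - + n * k * (𝟙[ w ≡ 0 ] + 𝟙[ w ≡ n ])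

  weight-end : ∀ {w i₀ iₙ} → krawtchouk w (n ∸ w) m ≡ k → 𝟙[ w ≡ 0 ] ≡ i₀ → 𝟙[ w ≡ n ] ≡ iₙ → i₀ + iₙ ≡ 1ℤ → weight w ≡ 0ℤ
  weight-end {w} {i₀} {iₙ} krawtchouk≡k i₀≡ iₙ≡ sum≡1 = begin
    (+ n₁ * krawtchouk w (n ∸ w) m + k) - + n * k * (𝟙[ w ≡ 0 ] + 𝟙[ w ≡ n ])
      ≡⟨ cong₂ (λ x y → (+ n₁ * x + k) - + n * k * y) krawtchouk≡k (trans (cong₂ _+_ i₀≡ iₙ≡) sum≡1) ⟩
    (+ n₁ * k + k) - + n * k * 1ℤ ≡⟨ cong (λ x → (+ n₁ * k + k) - + x * k * 1ℤ) n≡1+n₁ ⟩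
    (+ n₁ * k + k) - + suc n₁ * k * 1ℤ ≡⟨ cong (λ x → (+ n₁ * k + k) - x * k * 1ℤ) (pos-+ 1 n₁) ⟩
    (+ n₁ * k + k) - (1ℤ + + n₁) * k * 1ℤ ≡⟨ cancel (+ n₁) k ⟩
    0ℤ ∎
    where
    cancel : ∀ a k → (a * k + k) - (1ℤ + a) * k * 1ℤ ≡ 0ℤ
    cancel = solve-∀

  weight-nonneg : ∀ {w} → w ℕ.≤ n → 0ℤ ≤ weight w × (weight w ≡ 0ℤ → Support w)
  weight-nonneg {w} w≤n with w ℕ.≟ 0 | w ℕ.≟ n
  ... | yes refl | _ = ≤-reflexive (sym (weight-end {0} krawtchouk-at-0 (𝟙-≡ {0} refl) (𝟙-≢ (ℕ.<⇒≢ n>0)) refl)) , λ _ → inj₁ refl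
  ... | no _ | yes refl = ≤-reflexive (sym (weight-end {n} (krawtchouk-at-n {h} m≡h+h) (𝟙-≢ (ℕ.>⇒≢ n>0)) (𝟙-≡ {n} refl) refl)) , λ _ → inj₂ (inj₁ refl)
  ... | no w≢0 | no w≢n = subst (λ e → 0ℤ ≤ e × (e ≡ 0ℤ → Support w)) (sym weight≡eigen)
                            (proj₁ eigen-bound , inj₂ ∘ inj₂ ∘ proj₂ eigen-bound)
    where
    eigen-bound = eigen-nonneg (ℕ.≤∧≢⇒< w≤n w≢n)
    weight≡eigen : weight w ≡ eigen w
    weight≡eigen = begin
      eigen w - + n * k * (𝟙[ w ≡ 0 ] + 𝟙[ w ≡ n ]) ≡⟨ cong₂ (λ x y → eigen w - + n * k * (x + y)) (𝟙-≢ w≢0) (𝟙-≢ w≢n) ⟩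
      eigen w - + n * k * 0ℤ ≡⟨ cong (λ x → eigen w - x) (*-zeroʳ (+ n * k)) ⟩
      eigen w - 0ℤ ≡⟨ +-identityʳ (eigen w) ⟩
      eigen w ∎

  -- The levels 2 and n − 2 coincide when n = 4, and ν must count that level once.
  ι : ℤ
  ι = 1ℤ - 𝟙[ 2 ≡ n ∸ 2 ]

  ν : ℕ → ℤ
  ν w = 𝟙[ w ≡ 0 ] + 𝟙[ w ≡ n ] + 𝟙[ w ≡ 2 ] + ι * 𝟙[ w ≡ n ∸ 2 ]

  ν-support : ∀ {w} → Support w → ν w ≡ 1ℤ
  ν-support (inj₁ refl) = begin
    1ℤ + 𝟙[ 0 ≡ n ] + 0ℤ + ι * 𝟙[ 0 ≡ n ∸ 2 ]
      ≡⟨ cong₂ (λ x y → 1ℤ + x + 0ℤ + ι * y) (𝟙-≢ (ℕ.<⇒≢ n>0)) (𝟙-≢ (ℕ.<⇒≢ n∸2>0)) ⟩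
    1ℤ + ι * 0ℤ ≡⟨ cong (λ x → 1ℤ + x) (*-zeroʳ ι) ⟩
    1ℤ ∎
  ν-support (inj₂ (inj₁ refl)) = begin
    𝟙[ n ≡ 0 ] + 𝟙[ n ≡ n ] + 𝟙[ n ≡ 2 ] + ι * 𝟙[ n ≡ n ∸ 2 ]
      ≡⟨ cong₂ _+_ (cong₂ _+_ (cong₂ _+_ (𝟙-≢ (ℕ.>⇒≢ n>0)) (𝟙-≡ {n} refl)) (𝟙-≢ (ℕ.>⇒≢ 2<n)))
                   (cong (ι *_) (𝟙-≢ (ℕ.>⇒≢ n∸2<n))) ⟩
    1ℤ + ι * 0ℤ ≡⟨ cong (λ x → 1ℤ + x) (*-zeroʳ ι) ⟩
    1ℤ ∎
  ν-support (inj₂ (inj₂ (inj₁ refl))) = begin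
    0ℤ + 𝟙[ 2 ≡ n ] + 1ℤ + ι * 𝟙[ 2 ≡ n ∸ 2 ] ≡⟨ cong (λ x → 0ℤ + x + 1ℤ + ι * 𝟙[ 2 ≡ n ∸ 2 ]) (𝟙-≢ (ℕ.<⇒≢ 2<n)) ⟩
    1ℤ + (1ℤ - 𝟙[ 2 ≡ n ∸ 2 ]) * 𝟙[ 2 ≡ n ∸ 2 ] ≡⟨ cong (λ x → 1ℤ + x) (𝟙-complement-* 2 (n ∸ 2)) ⟩
    1ℤ ∎
  ν-support {w} (inj₂ (inj₂ (inj₂ 2+w≡n))) = begin
    𝟙[ w ≡ 0 ] + 𝟙[ w ≡ n ] + 𝟙[ w ≡ 2 ] + (1ℤ - 𝟙[ 2 ≡ n ∸ 2 ]) * 𝟙[ w ≡ n ∸ 2 ]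
      ≡⟨ cong₂ (λ x y → x + y + 𝟙[ w ≡ 2 ] + (1ℤ - 𝟙[ 2 ≡ n ∸ 2 ]) * 𝟙[ w ≡ n ∸ 2 ]) (𝟙-≢ w≢0) (𝟙-≢ (ℕ.<⇒≢ w<n)) ⟩
    0ℤ + 𝟙[ w ≡ 2 ] + (1ℤ - 𝟙[ 2 ≡ n ∸ 2 ]) * 𝟙[ w ≡ n ∸ 2 ]
      ≡⟨ cong (_+ (1ℤ - 𝟙[ 2 ≡ n ∸ 2 ]) * 𝟙[ w ≡ n ∸ 2 ]) (+-identityˡ 𝟙[ w ≡ 2 ]) ⟩
    𝟙[ w ≡ 2 ] + (1ℤ - 𝟙[ 2 ≡ n ∸ 2 ]) * 𝟙[ w ≡ n ∸ 2 ]
      ≡⟨ cong₂ (λ x y → 𝟙[ w ≡ 2 ] + (1ℤ - 𝟙[ 2 ≡ x ]) * y) (sym w≡n∸2) (𝟙-≡ w≡n∸2) ⟩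
    𝟙[ w ≡ 2 ] + (1ℤ - 𝟙[ 2 ≡ w ]) * 1ℤ ≡⟨ cong (λ x → 𝟙[ w ≡ 2 ] + (1ℤ - x) * 1ℤ) (𝟙-sym 2 w) ⟩
    𝟙[ w ≡ 2 ] + (1ℤ - 𝟙[ w ≡ 2 ]) * 1ℤ ≡⟨ cancel 𝟙[ w ≡ 2 ] ⟩
    1ℤ ∎
    where
    w≡n∸2 : w ≡ n ∸ 2
    w≡n∸2 = trans (sym (ℕ.m+n∸m≡n 2 w)) (cong (_∸ 2) 2+w≡n)
    w<n : w ℕ.< n
    w<n = subst (w ℕ.<_) 2+w≡n (ℕ.m<n+m w (s≤s z≤n))
    w≢0 : w ≢ 0
    w≢0 w≡0 = ℕ.<⇒≢ 2<n (trans (cong (2 ℕ.+_) (sym w≡0)) 2+w≡n)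
    cancel : ∀ i → i + (1ℤ - i) * 1ℤ ≡ 1ℤ
    cancel = solve-∀

  module IndependentIndicator (g : Subset n → ℤ)
    (g-idempotent : ∀ x → g x * g x ≡ g x)
    (g-even : ∀ x → g x * walsh ⊤ x ≡ g x)
    (g-independent : ∀ D x → ∣ D ∣ ≡ m → g (x △ D) * g x ≡ 0ℤ) where

    open EvenSupport g g-even

    S : ℤ
    S = ∑ g

    F : Subset n → ℤ
    F = fourier g

    autocorrelation-at-m : ∑ (λ J → levelSum m J * (F J * F J)) ≡ 0ℤ
    autocorrelation-at-m = begin
      ∑ (λ J → levelSum m J * (F J * F J)) ≡⟨ wiener-khinchin (λ D → 𝟙[ ∣ D ∣ ≡ m ]) g ⟩
      (+ 2) ^ n * ∑ (λ D → 𝟙[ ∣ D ∣ ≡ m ] * ∑ (λ x → g (x △ D) * g x)) ≡⟨ cong ((+ 2) ^ n *_) (trans (∑-cong {n} no-edge) (∑-0 {n})) ⟩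
      (+ 2) ^ n * 0ℤ ≡⟨ *-zeroʳ ((+ 2) ^ n) ⟩
      0ℤ ∎
      where
      no-edge : ∀ D → 𝟙[ ∣ D ∣ ≡ m ] * ∑ (λ x → g (x △ D) * g x) ≡ 0ℤ
      no-edge D with ∣ D ∣ ℕ.≟ m
      ... | yes |D|≡m = trans (cong (𝟙[ ∣ D ∣ ≡ m ] *_) (trans (∑-cong {n} (λ x → g-independent D x |D|≡m)) (∑-0 {n}))) (*-zeroʳ 𝟙[ ∣ D ∣ ≡ m ])
      ... | no |D|≢m = trans (cong (_* ∑ (λ x → g (x △ D) * g x)) (𝟙-≢ |D|≢m)) (*-zeroˡ (∑ (λ x → g (x △ D) * g x)))

    weighted-energy : ∑ (λ J → weight ∣ J ∣ * (F J * F J)) ≡ k * S * ((+ 2) ^ n - + 2 * (+ n * S))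
    weighted-energy = begin
      ∑ (λ J → weight ∣ J ∣ * F² J)
        ≡⟨ ∑-cong {n} (λ J → trans (cong (λ L → (+ n₁ * L + k - N * (𝟙[ ∣ J ∣ ≡ 0 ] + 𝟙[ ∣ J ∣ ≡ n ])) * F² J) (sym (levelSum≡krawtchouk m J)))
                                   (expand (+ n₁) (levelSum m J) k N 𝟙[ ∣ J ∣ ≡ 0 ] 𝟙[ ∣ J ∣ ≡ n ] (F² J))) ⟩
      ∑ (λ J → (+ n₁ * LF² J + k * F² J) + (- N) * (F²₀ J + F²ₙ J))
        ≡⟨ ∑-+ {n} (λ J → + n₁ * LF² J + k * F² J) (λ J → (- N) * (F²₀ J + F²ₙ J)) ⟩
      ∑ (λ J → + n₁ * LF² J + k * F² J) + ∑ (λ J → (- N) * (F²₀ J + F²ₙ J))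
        ≡⟨ cong₂ _+_ (∑-linear (+ n₁) k LF² F²) (trans (∑-*ˡ (- N) (λ J → F²₀ J + F²ₙ J)) (cong (- N *_) (∑-+ F²₀ F²ₙ))) ⟩
      (+ n₁ * ∑ LF² + k * ∑ F²) + (- N) * (∑ F²₀ + ∑ F²ₙ)
        ≡⟨ cong₂ (λ z t → (+ n₁ * ∑ LF² + k * ∑ F²) + (- N) * (z + t)) (∑-level-0 F²) (∑-level-top F²) ⟩
      (+ n₁ * ∑ LF² + k * ∑ F²) + (- N) * (F² ⊥ + F² ⊤)
        ≡⟨ cong₂ (λ a b → (+ n₁ * a + k * b) + (- N) * (F² ⊥ + F² ⊤)) autocorrelation-at-m energy ⟩
      (+ n₁ * 0ℤ + k * ((+ 2) ^ n * S)) + (- N) * (F² ⊥ + F² ⊤)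
        ≡⟨ cong₂ (λ a b → (+ n₁ * 0ℤ + k * ((+ 2) ^ n * S)) + (- N) * (a * a + b * b)) (fourier-⊥ g) fourier-⊤ ⟩
      (+ n₁ * 0ℤ + k * ((+ 2) ^ n * S)) + (- (+ n * k)) * (S * S + S * S) ≡⟨ simplify (+ n₁) k ((+ 2) ^ n) (+ n) S ⟩
      k * S * ((+ 2) ^ n - + 2 * (+ n * S)) ∎
      where
      N = + n * k
      F² LF² F²₀ F²ₙ : Subset n → ℤ
      F² J = F J * F J
      LF² J = levelSum m J * F² J
      F²₀ J = 𝟙[ ∣ J ∣ ≡ 0 ] * F² J
      F²ₙ J = 𝟙[ ∣ J ∣ ≡ n ] * F² J
      energy : ∑ F² ≡ (+ 2) ^ n * S
      energy = trans (parseval g g) (cong ((+ 2) ^ n *_) (∑-cong {n} g-idempotent))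
      expand : ∀ a L k N i₀ iₙ f → (a * L + k - N * (i₀ + iₙ)) * f ≡ (a * (L * f) + k * f) + (- N) * (i₀ * f + iₙ * f)
      expand = solve-∀
      simplify : ∀ a k P n S → (a * 0ℤ + k * (P * S)) + (- (n * k)) * (S * S + S * S) ≡ k * S * (P - + 2 * (n * S))
      simplify = solve-∀

    g-nonneg : ∀ x → 0ℤ ≤ g x
    g-nonneg x = subst (0ℤ ≤_) (g-idempotent x) (square-nonneg (g x))

    weighted-energy-nonneg : 0ℤ ≤ ∑ (λ J → weight ∣ J ∣ * (F J * F J))
    weighted-energy-nonneg = ∑-nonneg _ (λ J → *-nonneg (proj₁ (weight-nonneg (∣p∣≤n J))) (square-nonneg (F J)))

    ratio-bound : + 2 * (+ n * S) ≤ (+ 2) ^ n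
    ratio-bound with 0ℤ ≟ S
    ... | yes 0≡S = subst (_≤ (+ 2) ^ n) (sym 2nS≡0) (subst (0ℤ ≤_) (sym (pos-2^ n)) (+≤+ z≤n))
      where
      2nS≡0 : + 2 * (+ n * S) ≡ 0ℤ
      2nS≡0 = trans (cong (λ s → + 2 * (+ n * s)) (sym 0≡S)) (cong (+ 2 *_) (*-zeroʳ (+ n)))
    ... | no 0≢S = 0≤i-j⇒j≤i (*-cancelˡ-≤-0< 0<kS
                       (subst₂ _≤_ (sym (*-zeroʳ (k * S))) weighted-energy weighted-energy-nonneg))
      where
      0<kS : 0ℤ < k * S
      0<kS = subst (_< k * S) (*-zeroʳ k) (*-monoˡ-<-0< (+<+ (Binomial.C-pos (ℕ.m≤m+n m m))) (≤∧≢⇒< (∑-nonneg g g-nonneg) 0≢S))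

    fourier-support : + 2 * (+ n * S) ≡ (+ 2) ^ n → ∀ J → F J ≡ 0ℤ ⊎ Support ∣ J ∣
    fourier-support tight J = Sum.swap (Sum.map (proj₂ (weight-nonneg (∣p∣≤n J))) square≡0⇒≡0 (i*j≡0⇒i≡0∨j≡0 (weight ∣ J ∣) term≡0))
      where
      term-nonneg : ∀ J → 0ℤ ≤ weight ∣ J ∣ * (F J * F J)
      term-nonneg J = *-nonneg (proj₁ (weight-nonneg (∣p∣≤n J))) (square-nonneg (F J))
      energy≡0 : ∑ (λ J → weight ∣ J ∣ * (F J * F J)) ≡ 0ℤ
      energy≡0 = begin
        ∑ (λ J → weight ∣ J ∣ * (F J * F J)) ≡⟨ weighted-energy ⟩
        k * S * ((+ 2) ^ n - + 2 * (+ n * S)) ≡⟨ cong (λ t → k * S * ((+ 2) ^ n - t)) tight ⟩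
        k * S * ((+ 2) ^ n - (+ 2) ^ n) ≡⟨ cong (k * S *_) (+-inverseʳ ((+ 2) ^ n)) ⟩
        k * S * 0ℤ ≡⟨ *-zeroʳ (k * S) ⟩
        0ℤ ∎
      term≡0 : weight ∣ J ∣ * (F J * F J) ≡ 0ℤ
      term≡0 = ∑-nonneg-≡0 (λ J → weight ∣ J ∣ * (F J * F J)) term-nonneg energy≡0 J
      square≡0⇒≡0 : F J * F J ≡ 0ℤ → F J ≡ 0ℤ
      square≡0⇒≡0 F²≡0 = Sum.reduce (i*j≡0⇒i≡0∨j≡0 (F J) F²≡0)

    module _ (a : Subset n) (a-even : walsh ⊤ a ≡ 1ℤ) where

      u : Subset n → ℤ
      u J = F J * walsh J a

      u-∁ : ∀ J → u (∁ J) ≡ u J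
      u-∁ J = cong₂ _*_ (fourier-∁ J) (trans (walsh-∁ J a) (trans (cong (_* walsh J a) a-even) (*-identityˡ _)))

      mirror-level : ∑ (λ J → 𝟙[ ∣ J ∣ ≡ n ∸ 2 ] * u J) ≡ ∑ (λ J → 𝟙[ ∣ J ∣ ≡ 2 ] * u J)
      mirror-level = trans (sym (∑-∁ (λ J → 𝟙[ ∣ J ∣ ≡ n ∸ 2 ] * u J))) (∑-cong {n} (λ J → cong₂ _*_ (𝟙-∁ (ℕ.<⇒≤ 2<n) J) (u-∁ J)))

      decomposition : + 2 * (+ n * S) ≡ (+ 2) ^ n → (+ 2) ^ n * g a ≡ + 2 * S + (1ℤ + ι) * ∑ (λ J → 𝟙[ ∣ J ∣ ≡ 2 ] * u J)
      decomposition tight = begin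
        (+ 2) ^ n * g a ≡⟨ fourier-inversion g a ⟨
        ∑ u ≡⟨ ∑-cong {n} u≡νu ⟩
        ∑ (λ J → ν ∣ J ∣ * u J)
          ≡⟨ ∑-cong {n} (λ J → expand 𝟙[ ∣ J ∣ ≡ 0 ] 𝟙[ ∣ J ∣ ≡ n ] 𝟙[ ∣ J ∣ ≡ 2 ] ι 𝟙[ ∣ J ∣ ≡ n ∸ 2 ] (u J)) ⟩
        ∑ (λ J → U₀ J + Uₙ J + U₂ J + ι * U₋₂ J) ≡⟨ ∑-+ {n} (λ J → U₀ J + Uₙ J + U₂ J) (λ J → ι * U₋₂ J) ⟩
        ∑ (λ J → U₀ J + Uₙ J + U₂ J) + ∑ (λ J → ι * U₋₂ J)
          ≡⟨ cong₂ _+_ (trans (∑-+ {n} (λ J → U₀ J + Uₙ J) U₂) (cong (_+ ∑ U₂) (∑-+ {n} U₀ Uₙ))) (∑-*ˡ ι U₋₂) ⟩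
        ∑ U₀ + ∑ Uₙ + ∑ U₂ + ι * ∑ U₋₂ ≡⟨ cong₂ (λ x y → x + y + ∑ U₂ + ι * ∑ U₋₂) (∑-level-0 u) (∑-level-top u) ⟩
        u ⊥ + u ⊤ + ∑ U₂ + ι * ∑ U₋₂ ≡⟨ cong₂ (λ x y → x + y + ∑ U₂ + ι * ∑ U₋₂) u⊥≡S u⊤≡S ⟩
        S + S + ∑ U₂ + ι * ∑ U₋₂ ≡⟨ cong (λ x → S + S + ∑ U₂ + ι * x) mirror-level ⟩
        S + S + ∑ U₂ + ι * ∑ U₂ ≡⟨ collect S (∑ U₂) ι ⟩
        + 2 * S + (1ℤ + ι) * ∑ U₂ ∎
        where
        U₀ Uₙ U₂ U₋₂ : Subset n → ℤ
        U₀ J = 𝟙[ ∣ J ∣ ≡ 0 ] * u J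
        Uₙ J = 𝟙[ ∣ J ∣ ≡ n ] * u J
        U₂ J = 𝟙[ ∣ J ∣ ≡ 2 ] * u J
        U₋₂ J = 𝟙[ ∣ J ∣ ≡ n ∸ 2 ] * u J
        u≡νu : ∀ J → u J ≡ ν ∣ J ∣ * u J
        u≡νu J = Sum.[ vanishing , supported ] (fourier-support tight J)
          where
          vanishing : F J ≡ 0ℤ → u J ≡ ν ∣ J ∣ * u J
          vanishing F≡0 = trans (cong (_* walsh J a) F≡0) (sym (trans (cong (λ f → ν ∣ J ∣ * (f * walsh J a)) F≡0) (*-zeroʳ (ν ∣ J ∣))))
          supported : Support ∣ J ∣ → u J ≡ ν ∣ J ∣ * u J
          supported supp = sym (trans (cong (_* u J) (ν-support supp)) (*-identityˡ (u J)))
        u⊥≡S : u ⊥ ≡ S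
        u⊥≡S = trans (cong₂ _*_ (fourier-⊥ g) (walsh-⊥ a)) (*-identityʳ S)
        u⊤≡S : u ⊤ ≡ S
        u⊤≡S = trans (cong₂ _*_ fourier-⊤ a-even) (*-identityʳ S)
        expand : ∀ i₀ iₙ i₂ ι i₋₂ x → (i₀ + iₙ + i₂ + ι * i₋₂) * x ≡ i₀ * x + iₙ * x + i₂ * x + ι * (i₋₂ * x)
        expand = solve-∀
        collect : ∀ s x ι → s + s + x + ι * x ≡ + 2 * s + (1ℤ + ι) * x
        collect = solve-∀

module PairSums where

  open import Data.Bool using (true; false; if_then_else_)
  open import Data.Nat using (zero; suc)
  open import Data.Fin using (Fin; zero; suc)
  open import Data.Fin.Properties using (_<?_)
  open import Data.Integer using (ℤ; 0ℤ; _+_; _*_)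
  open import Data.Integer.Properties using (+-identityˡ; +-assoc; +-comm; *-zeroʳ; *-distribˡ-+)
  open import Data.List using (List; []; _∷_; map; filter; concatMap; allFin; tabulate; _++_; foldr)
  open import Data.Vec using ([]; _∷_)
  open import Data.Fin.Subset using (Subset; ∣_∣; ⁅_⁆; ⊥)
  open import Data.Fin.Subset.Properties using (∪-identityˡ)
  open import Data.Product using (_,_)
  open import Relation.Nullary using (does; Dec)
  open import Relation.Binary.PropositionalEquality
  open import Defs using (twoSubsets; pairSet)
  open ≡-Reasoning
  open CubeSum
  open HammingLevels

  sumℤ : List ℤ → ℤ
  sumℤ = foldr _+_ 0ℤ

  sumℤ-++ : ∀ {A : Set} (f : A → ℤ) (xs ys : List A) → sumℤ (map f (xs ++ ys)) ≡ sumℤ (map f xs) + sumℤ (map f ys)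
  sumℤ-++ f [] ys = sym (+-identityˡ _)
  sumℤ-++ f (x ∷ xs) ys = trans (cong (f x +_) (sumℤ-++ f xs ys)) (sym (+-assoc (f x) _ _))

  sumℤ-concatMap : ∀ {A B : Set} (f : B → ℤ) (g : A → List B) (xs : List A) →
    sumℤ (map f (concatMap g xs)) ≡ sumℤ (map (λ x → sumℤ (map f (g x))) xs)
  sumℤ-concatMap f g [] = refl
  sumℤ-concatMap f g (x ∷ xs) = trans (sumℤ-++ f (g x) (concatMap g xs)) (cong (sumℤ (map f (g x)) +_) (sumℤ-concatMap f g xs))

  sumℤ-map-map : ∀ {A B : Set} (f : B → ℤ) (g : A → B) (xs : List A) → sumℤ (map f (map g xs)) ≡ sumℤ (map (λ x → f (g x)) xs)
  sumℤ-map-map f g [] = refl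
  sumℤ-map-map f g (x ∷ xs) = cong (f (g x) +_) (sumℤ-map-map f g xs)

  sumℤ-filter : ∀ {A : Set} {P : A → Set} (P? : ∀ x → Dec (P x)) (f : A → ℤ) (xs : List A) →
    sumℤ (map f (filter P? xs)) ≡ sumℤ (map (λ x → if does (P? x) then f x else 0ℤ) xs)
  sumℤ-filter P? f [] = refl
  sumℤ-filter P? f (x ∷ xs) with does (P? x)
  ... | true = cong (f x +_) (sumℤ-filter P? f xs)
  ... | false = trans (sumℤ-filter P? f xs) (sym (+-identityˡ _))

  sumℤ-*ˡ : ∀ {A : Set} (c : ℤ) (f : A → ℤ) (xs : List A) → sumℤ (map (λ x → c * f x) xs) ≡ c * sumℤ (map f xs)
  sumℤ-*ˡ c f [] = sym (*-zeroʳ c)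
  sumℤ-*ˡ c f (x ∷ xs) = trans (cong (λ s → c * f x + s) (sumℤ-*ˡ c f xs)) (sym (*-distribˡ-+ c (f x) _))

  ∑Fin : ∀ n → (Fin n → ℤ) → ℤ
  ∑Fin zero f = 0ℤ
  ∑Fin (suc n) f = f zero + ∑Fin n (λ i → f (suc i))

  ∑Fin-cong : ∀ n {f g : Fin n → ℤ} → (∀ i → f i ≡ g i) → ∑Fin n f ≡ ∑Fin n g
  ∑Fin-cong zero f≡g = refl
  ∑Fin-cong (suc n) f≡g = cong₂ _+_ (f≡g zero) (∑Fin-cong n (λ i → f≡g (suc i)))

  sumℤ-tabulate : ∀ n {A : Set} (g : Fin n → A) (f : A → ℤ) → sumℤ (map f (tabulate g)) ≡ ∑Fin n (λ i → f (g i))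
  sumℤ-tabulate zero g f = refl
  sumℤ-tabulate (suc n) g f = cong (f (g zero) +_) (sumℤ-tabulate n (λ i → g (suc i)) f)

  pairSum : ∀ n → (Subset n → ℤ) → ℤ
  pairSum n v = ∑Fin n (λ i → ∑Fin n (λ j → if does (i <? j) then v (pairSet (i , j)) else 0ℤ))

  sumℤ-twoSubsets : ∀ n (v : Subset n → ℤ) → sumℤ (map (λ p → v (pairSet p)) (twoSubsets n)) ≡ pairSum n v
  sumℤ-twoSubsets n v = begin
    sumℤ (map (λ p → v (pairSet p)) (twoSubsets n)) ≡⟨ sumℤ-concatMap _ _ (allFin n) ⟩
    sumℤ (map (λ i → sumℤ (map (λ p → v (pairSet p)) (map (λ j → (i , j)) (filter (i <?_) (allFin n))))) (allFin n))
      ≡⟨ sumℤ-tabulate n (λ i → i) _ ⟩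
    ∑Fin n (λ i → sumℤ (map (λ p → v (pairSet p)) (map (λ j → (i , j)) (filter (i <?_) (allFin n)))))
      ≡⟨ ∑Fin-cong n (λ i → trans (sumℤ-map-map _ _ (filter (i <?_) (allFin n))) (trans (sumℤ-filter (i <?_) _ (allFin n)) (sumℤ-tabulate n (λ j → j) _))) ⟩
    pairSum n v ∎

  ∑-level-1 : ∀ n (v : Subset n → ℤ) → ∑ (λ J → 𝟙[ ∣ J ∣ ≡ 1 ] * v J) ≡ ∑Fin n (λ i → v ⁅ i ⁆)
  ∑-level-1 zero v = refl
  ∑-level-1 (suc n) v = begin
    ∑ (λ J → 𝟙[ ∣ J ∣ ≡ 1 ] * v (false ∷ J)) + ∑ (λ J → 𝟙[ ∣ J ∣ ≡ 0 ] * v (true ∷ J))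
      ≡⟨ cong₂ _+_ (∑-level-1 n (λ J → v (false ∷ J))) (∑-level-0 (λ J → v (true ∷ J))) ⟩
    ∑Fin n (λ i → v (false ∷ ⁅ i ⁆)) + v (true ∷ ⊥) ≡⟨ +-comm (∑Fin n (λ i → v (false ∷ ⁅ i ⁆))) (v (true ∷ ⊥)) ⟩
    ∑Fin (suc n) (λ i → v ⁅ i ⁆) ∎

  ∑-level-2 : ∀ n (v : Subset n → ℤ) → ∑ (λ J → 𝟙[ ∣ J ∣ ≡ 2 ] * v J) ≡ pairSum n v
  ∑-level-2 zero v = refl
  ∑-level-2 (suc n) v = begin
    ∑ (λ J → 𝟙[ ∣ J ∣ ≡ 2 ] * v (false ∷ J)) + ∑ (λ J → 𝟙[ ∣ J ∣ ≡ 1 ] * v (true ∷ J))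
      ≡⟨ cong₂ _+_ (∑-level-2 n (λ J → v (false ∷ J))) (∑-level-1 n (λ J → v (true ∷ J))) ⟩
    pairSum n (λ J → v (false ∷ J)) + ∑Fin n (λ j → v (true ∷ ⁅ j ⁆))
      ≡⟨ +-comm (pairSum n (λ J → v (false ∷ J))) _ ⟩
    ∑Fin n (λ j → v (true ∷ ⁅ j ⁆)) + pairSum n (λ J → v (false ∷ J))
      ≡⟨ cong₂ _+_ (trans (∑Fin-cong n (λ j → cong (λ J → v (true ∷ J)) (sym (∪-identityˡ ⁅ j ⁆)))) (sym (+-identityˡ _)))
                   (∑Fin-cong n (λ i → sym (+-identityˡ _))) ⟩
    pairSum (suc n) v ∎

module Rationals where

  open import Data.Integer as ℤ using (ℤ; +_; 0ℤ; 1ℤ; -1ℤ)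
  import Data.Integer.Properties as ℤ
  open import Data.Integer.Tactic.RingSolver using (solve-∀)
  open import Data.Nat using (zero; suc)
  open import Data.Rational using (ℚ; 1ℚ; _+_; _*_; -_; 1/_; NonZero; ≢-nonZero)
  open import Data.Rational.Literals using (fromℤ)
  open import Data.Rational.Properties
    using (toℚᵘ-injective; toℚᵘ-homo-+; toℚᵘ-homo-*; toℚᵘ-homo‿-; toℚᵘ-cong; *-inverseʳ; *-zeroˡ; *-assoc; *-comm; *-identityʳ; *-distribʳ-+)
  open import Data.List using (List; []; _∷_; map)
  open import Data.Product using (Σ; _,_)
  open import Function using (_∘_)
  open import Defs using (signPow; sumℚ)
  open PairSums using (sumℤ)
  import Data.Rational.Unnormalised as ℚᵘ
  import Data.Rational.Unnormalised.Properties as ℚᵘ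
  open import Relation.Binary.PropositionalEquality
  open ≡-Reasoning

  fromℤ-+ : ∀ a b → fromℤ (a ℤ.+ b) ≡ fromℤ a + fromℤ b
  fromℤ-+ a b = toℚᵘ-injective (ℚᵘ.≃-sym (ℚᵘ.≃-trans (toℚᵘ-homo-+ (fromℤ a) (fromℤ b)) (ℚᵘ.*≡* (same a b))))
    where
    same : ∀ a b → (a ℤ.* 1ℤ ℤ.+ b ℤ.* 1ℤ) ℤ.* 1ℤ ≡ (a ℤ.+ b) ℤ.* (1ℤ ℤ.* 1ℤ)
    same = solve-∀

  fromℤ-* : ∀ a b → fromℤ (a ℤ.* b) ≡ fromℤ a * fromℤ b
  fromℤ-* a b = toℚᵘ-injective (ℚᵘ.≃-sym (ℚᵘ.≃-trans (toℚᵘ-homo-* (fromℤ a) (fromℤ b)) (ℚᵘ.*≡* (same a b))))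
    where
    same : ∀ a b → (a ℤ.* b) ℤ.* 1ℤ ≡ (a ℤ.* b) ℤ.* (1ℤ ℤ.* 1ℤ)
    same = solve-∀

  fromℤ-neg : ∀ a → fromℤ (ℤ.- a) ≡ - fromℤ a
  fromℤ-neg a = toℚᵘ-injective (ℚᵘ.≃-sym (ℚᵘ.≃-trans (toℚᵘ-homo‿- (fromℤ a)) (ℚᵘ.*≡* refl)))

  fromℤ-injective : ∀ {a b} → fromℤ a ≡ fromℤ b → a ≡ b
  fromℤ-injective {a} {b} eq with toℚᵘ-cong eq
  ... | ℚᵘ.*≡* a*1≡b*1 = trans (sym (ℤ.*-identityʳ a)) (trans a*1≡b*1 (ℤ.*-identityʳ b))


  fromℤ-inverse : ∀ {a} → a ≢ 0ℤ → Σ ℚ λ r → fromℤ a * r ≡ 1ℚ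
  fromℤ-inverse {a} a≢0 = 1/ fromℤ a , *-inverseʳ (fromℤ a)
    where
    instance
      nonZero : NonZero (fromℤ a)
      nonZero = ≢-nonZero (a≢0 ∘ fromℤ-injective)

  signPow≡fromℤ : ∀ k → signPow k ≡ fromℤ (-1ℤ ℤ.^ k)
  signPow≡fromℤ zero = refl
  signPow≡fromℤ (suc k) = begin
    - signPow k ≡⟨ cong -_ (signPow≡fromℤ k) ⟩
    - fromℤ (-1ℤ ℤ.^ k) ≡⟨ fromℤ-neg (-1ℤ ℤ.^ k) ⟨
    fromℤ (ℤ.- (-1ℤ ℤ.^ k)) ≡⟨ cong fromℤ (ℤ.-1*i≡-i (-1ℤ ℤ.^ k)) ⟨
    fromℤ (-1ℤ ℤ.^ suc k) ∎

  sumℚ-fromℤ : ∀ {B : Set} (L : List B) (x y : B → ℤ) (r : ℚ) →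
    sumℚ (map (λ p → fromℤ (x p) * (fromℤ (y p) * r)) L) ≡ fromℤ (sumℤ (map (λ p → x p ℤ.* y p) L)) * r
  sumℚ-fromℤ [] x y r = sym (*-zeroˡ r)
  sumℚ-fromℤ (p ∷ L) x y r = begin
    fromℤ (x p) * (fromℤ (y p) * r) + sumℚ (map (λ p → fromℤ (x p) * (fromℤ (y p) * r)) L)
      ≡⟨ cong₂ _+_ (sym (*-assoc (fromℤ (x p)) (fromℤ (y p)) r)) (sumℚ-fromℤ L x y r) ⟩
    fromℤ (x p) * fromℤ (y p) * r + fromℤ rest * r
      ≡⟨ *-distribʳ-+ r (fromℤ (x p) * fromℤ (y p)) (fromℤ rest) ⟨
    (fromℤ (x p) * fromℤ (y p) + fromℤ rest) * r
      ≡⟨ cong (_* r) (trans (fromℤ-+ (x p ℤ.* y p) rest) (cong (_+ fromℤ rest) (fromℤ-* (x p) (y p)))) ⟨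
    fromℤ (x p ℤ.* y p ℤ.+ rest) * r ∎
    where
    rest = sumℤ (map (λ p → x p ℤ.* y p) L)

  sumℚ-divide : ∀ {B : Set} (L : List B) (x y : B → ℤ) {s P g : ℤ} {r : ℚ} → fromℤ P * r ≡ 1ℚ →
    sumℤ (map (λ p → x p ℤ.* y p) L) ℤ.+ s ≡ P ℤ.* g →
    sumℚ (map (λ p → fromℤ (x p) * (fromℤ (y p) * r)) L) + fromℤ s * r ≡ fromℤ g
  sumℚ-divide L x y {s} {P} {g} {r} Pr≡1 total+s≡Pg = begin
    sumℚ (map (λ p → fromℤ (x p) * (fromℤ (y p) * r)) L) + fromℤ s * r ≡⟨ cong (_+ fromℤ s * r) (sumℚ-fromℤ L x y r) ⟩
    fromℤ total * r + fromℤ s * r ≡⟨ *-distribʳ-+ r (fromℤ total) (fromℤ s) ⟨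
    (fromℤ total + fromℤ s) * r ≡⟨ cong (_* r) (fromℤ-+ total s) ⟨
    fromℤ (total ℤ.+ s) * r ≡⟨ cong (λ z → fromℤ z * r) total+s≡Pg ⟩
    fromℤ (P ℤ.* g) * r ≡⟨ cong (_* r) (trans (fromℤ-* P g) (*-comm (fromℤ P) (fromℤ g))) ⟩
    fromℤ g * fromℤ P * r ≡⟨ *-assoc (fromℤ g) (fromℤ P) r ⟩
    fromℤ g * (fromℤ P * r) ≡⟨ cong (fromℤ g *_) Pr≡1 ⟩
    fromℤ g * 1ℚ ≡⟨ *-identityʳ (fromℤ g) ⟩
    fromℤ g ∎
    where
    total = sumℤ (map (λ p → x p ℤ.* y p) L)

module Vertices where

  open import Data.Bool using (Bool; true; false; not; if_then_else_)
  import Data.Bool as Bool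
  open import Data.Bool.Properties using (not-involutive)
  import Data.Nat.Properties as ℕ
  open import Data.Nat.Divisibility using (_∣_; divides; ∣m+n∣m⇒∣n)
  open import Data.Nat.DivMod using (_/_; m*n/n≡m)
  open import Data.Integer using (ℤ; +_; 0ℤ; 1ℤ; _+_; _*_)
  open import Data.Integer.Properties using (*-identityʳ; *-zeroˡ; *-zeroʳ; +-identityʳ)
  open import Data.Fin using (Fin; fromℕ<)
  open import Data.Fin.Properties using (toℕ-fromℕ<)
  open import Data.Fin.Subset using (Subset; ∣_∣; ∁; _∉_; ⊤)
  open import Data.Fin.Subset.Properties using (∣∁p∣≡n∸∣p∣; ∣p∣≤n; x∉p⇒x∈∁p)
  open import Data.List using (List; []; _∷_; length)
  import Data.List.Membership.DecPropositional as DecMembership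
  open import Data.List.Membership.Propositional using (_∈_)
  open import Data.List.Relation.Unary.All using (All; _∷_)
  open import Data.List.Relation.Unary.AllPairs using (_∷_)
  open import Data.List.Relation.Unary.Any using (here; there)
  open import Data.List.Relation.Unary.Unique.Propositional using (Unique)
  open import Data.Vec using ([]; _∷_)
  open import Data.Vec.Properties using (≡-dec)
  import Data.Vec.Properties as Vec
  open import Data.Product using (∃-syntax; _×_; _,_; proj₁; proj₂)
  open import Data.Sum using (_⊎_; inj₁; inj₂)
  open import Data.Integer.Tactic.RingSolver using (solve-∀)
  open import Relation.Binary.PropositionalEquality
  open import Relation.Nullary using (¬_; does; yes; no; contradiction)
  open import Relation.Nullary.Decidable using (dec-false)
  open import Defs using (_△_; IsVertex; IsIndependent)
  open ≡-Reasoning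
  open CubeSum
  open Walsh using (walsh; walsh-⊤-even)

  module _ {n : ℕ} where

    open DecMembership (≡-dec {n = n} Bool._≟_) using (_∈?_)

    indicator : List (Subset n) → Subset n → ℤ
    indicator T A = if does (A ∈? T) then 1ℤ else 0ℤ

    indicator-∉ : ∀ {T A} → ¬ A ∈ T → indicator T A ≡ 0ℤ
    indicator-∉ {T} {A} A∉T rewrite dec-false (A ∈? T) A∉T = refl

    indicator-∷ : ∀ {a T} → All (a ≢_) T → ∀ A → indicator (a ∷ T) A ≡ δ A a + indicator T A
    indicator-∷ {a} {T} a∉T A with A ∈? T | ≡-dec Bool._≟_ A a
    ... | yes A∈T | yes refl = contradiction A∈T (All-≢⇒∉ a∉T)
      where
      All-≢⇒∉ : ∀ {T} → All (A ≢_) T → ¬ A ∈ T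
      All-≢⇒∉ (A≢B ∷ _) (here A≡B) = A≢B A≡B
      All-≢⇒∉ (_ ∷ A∉T) (there A∈T) = All-≢⇒∉ A∉T A∈T
    ... | yes _ | no A≢a = sym (cong (_+ 1ℤ) (δ-≢ A a A≢a))
    ... | no _ | yes refl = sym (cong (_+ 0ℤ) (δ-refl A))
    ... | no _ | no A≢a = sym (cong (_+ 0ℤ) (δ-≢ A a A≢a))

    ∑-indicator : ∀ {T} → Unique T → ∑ (indicator T) ≡ + length T
    ∑-indicator {[]} _ = ∑-0 {n}
    ∑-indicator {a ∷ T} (a∉T ∷ T-unique) = begin
      ∑ (indicator (a ∷ T)) ≡⟨ ∑-cong {n} (indicator-∷ a∉T) ⟩
      ∑ (λ A → δ A a + indicator T A) ≡⟨ ∑-+ {n} (λ A → δ A a) (indicator T) ⟩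
      ∑ (λ A → δ A a) + ∑ (indicator T)
        ≡⟨ cong₂ _+_ (trans (∑-cong {n} (λ A → sym (*-identityʳ (δ A a)))) (∑-δ a (λ _ → 1ℤ))) (∑-indicator T-unique) ⟩
      1ℤ + + length T ∎

  ∁-involutive : ∀ {n} (x : Subset n) → ∁ (∁ x) ≡ x
  ∁-involutive x = trans (sym (Vec.map-∘ not not x)) (trans (Vec.map-cong not-involutive x) (Vec.map-id x))

  △-cancelˡ : ∀ {n} (x d : Subset n) → (x △ d) △ x ≡ d
  △-cancelˡ [] [] = refl
  △-cancelˡ (true ∷ x) (true ∷ d) = cong (true ∷_) (△-cancelˡ x d)
  △-cancelˡ (true ∷ x) (false ∷ d) = cong (false ∷_) (△-cancelˡ x d)
  △-cancelˡ (false ∷ x) (true ∷ d) = cong (true ∷_) (△-cancelˡ x d)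
  △-cancelˡ (false ∷ x) (false ∷ d) = cong (false ∷_) (△-cancelˡ x d)

  ∁-△ˡ : ∀ {n} (a b : Subset n) → ∁ a △ b ≡ ∁ (a △ b)
  ∁-△ˡ [] [] = refl
  ∁-△ˡ (true ∷ a) (true ∷ b) = cong (true ∷_) (∁-△ˡ a b)
  ∁-△ˡ (true ∷ a) (false ∷ b) = cong (false ∷_) (∁-△ˡ a b)
  ∁-△ˡ (false ∷ a) (true ∷ b) = cong (false ∷_) (∁-△ˡ a b)
  ∁-△ˡ (false ∷ a) (false ∷ b) = cong (true ∷_) (∁-△ˡ a b)

  ∁-△ʳ : ∀ {n} (a b : Subset n) → a △ ∁ b ≡ ∁ (a △ b)
  ∁-△ʳ [] [] = refl
  ∁-△ʳ (true ∷ a) (true ∷ b) = cong (true ∷_) (∁-△ʳ a b)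
  ∁-△ʳ (true ∷ a) (false ∷ b) = cong (false ∷_) (∁-△ʳ a b)
  ∁-△ʳ (false ∷ a) (true ∷ b) = cong (false ∷_) (∁-△ʳ a b)
  ∁-△ʳ (false ∷ a) (false ∷ b) = cong (true ∷_) (∁-△ʳ a b)

  UpToComplement : ∀ {n} → Subset n → Subset n → Set
  UpToComplement A x = x ≡ A ⊎ x ≡ ∁ A

  △-upToComplement : ∀ {n} {A B y z : Subset n} → UpToComplement A y → UpToComplement B z → UpToComplement (A △ B) (y △ z)
  △-upToComplement (inj₁ refl) (inj₁ refl) = inj₁ refl
  △-upToComplement {A = A} {B} (inj₁ refl) (inj₂ refl) = inj₂ (∁-△ʳ A B)
  △-upToComplement {A = A} {B} (inj₂ refl) (inj₁ refl) = inj₂ (∁-△ˡ A B)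
  △-upToComplement {A = A} {B} (inj₂ refl) (inj₂ refl) = inj₁ (trans (∁-△ˡ A (∁ B)) (trans (cong ∁ (∁-△ʳ A B)) (∁-involutive (A △ B))))

  module IndependentSet {m : ℕ} (0<m : 0 ℕ.< m) (T : List (Subset (m ℕ.+ m))) (T-independent : IsIndependent (m ℕ.+ m) T) where

    n : ℕ
    n = m ℕ.+ m

    open DecMembership (≡-dec {n = n} Bool._≟_) using (_∈?_)

    vertex : ∀ {A} → A ∈ T → IsVertex n A
    vertex = proj₁ (proj₂ T-independent) _

    i₀ : Fin n
    i₀ = fromℕ< (ℕ.<-≤-trans 0<m (ℕ.m≤m+n m m))

    vertex-∌-i₀ : ∀ {A} → IsVertex n A → i₀ ∉ A
    vertex-∌-i₀ A-vertex = proj₂ A-vertex i₀ (toℕ-fromℕ< _)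

    ∁-nonvertex : ∀ {A} → IsVertex n A → ¬ ∁ A ∈ T
    ∁-nonvertex A-vertex ∁A∈T = vertex-∌-i₀ (vertex ∁A∈T) (x∉p⇒x∈∁p (vertex-∌-i₀ A-vertex))

    -- Defs stores the vertex {A, ∁A} as its representative A ∌ 0; lift marks both representatives.
    lift : Subset n → ℤ
    lift x = indicator T x + indicator T (∁ x)

    Represented : Subset n → Set
    Represented x = ∃[ A ] (A ∈ T × UpToComplement A x)

    lift-cases : ∀ x → lift x ≡ 0ℤ ⊎ (lift x ≡ 1ℤ × Represented x)
    lift-cases x with x ∈? T | ∁ x ∈? T
    ... | yes x∈T | yes ∁x∈T = contradiction ∁x∈T (∁-nonvertex (vertex x∈T))
    ... | yes x∈T | no _ = inj₂ (refl , x , x∈T , inj₁ refl)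
    ... | no _ | yes ∁x∈T = inj₂ (refl , ∁ x , ∁x∈T , inj₂ (sym (∁-involutive x)))
    ... | no _ | no _ = inj₁ refl

    product-vanishes : ∀ {a b} → a ≡ 0ℤ ⊎ b ≡ 0ℤ → a * b ≡ 0ℤ
    product-vanishes {b = b} (inj₁ refl) = *-zeroˡ b
    product-vanishes {a = a} (inj₂ refl) = *-zeroʳ a

    lift-idempotent : ∀ x → lift x * lift x ≡ lift x
    lift-idempotent x with lift-cases x
    ... | inj₁ lift≡0 = trans (cong₂ _*_ lift≡0 lift≡0) (sym lift≡0)
    ... | inj₂ (lift≡1 , _) = trans (cong₂ _*_ lift≡1 lift≡1) (sym lift≡1)

    even-∁ : ∀ {A : Subset n} → 2 ∣ ∣ A ∣ → 2 ∣ ∣ ∁ A ∣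
    even-∁ {A} 2∣|A| = subst (2 ∣_) (sym (∣∁p∣≡n∸∣p∣ A)) (∣m+n∣m⇒∣n (subst (2 ∣_) (sym (ℕ.m+[n∸m]≡n (∣p∣≤n A))) 2∣n) 2∣|A|)
      where
      2∣n : 2 ∣ n
      2∣n = divides m (trans (cong (m ℕ.+_) (sym (ℕ.+-identityʳ m))) (ℕ.*-comm 2 m))

    lift-even : ∀ x → lift x * walsh ⊤ x ≡ lift x
    lift-even x with lift-cases x
    ... | inj₁ lift≡0 = trans (cong (_* walsh ⊤ x) lift≡0) (trans (*-zeroˡ (walsh ⊤ x)) (sym lift≡0))
    ... | inj₂ (_ , A , A∈T , x≈A) = trans (cong (lift x *_) (walsh-⊤-even {x = x} (even x≈A))) (*-identityʳ (lift x))
      where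
      even : UpToComplement A x → 2 ∣ ∣ x ∣
      even (inj₁ refl) = proj₁ (vertex A∈T)
      even (inj₂ refl) = even-∁ {A} (proj₁ (vertex A∈T))

    n/2≡m : n / 2 ≡ m
    n/2≡m = trans (cong (_/ 2) (trans (cong (m ℕ.+_) (sym (ℕ.+-identityʳ m))) (ℕ.*-comm 2 m))) (m*n/n≡m m 2)

    lift-independent : ∀ D x → ∣ D ∣ ≡ m → lift (x △ D) * lift x ≡ 0ℤ
    lift-independent D x |D|≡m with lift-cases (x △ D) | lift-cases x
    ... | inj₁ lift≡0 | _ = product-vanishes {lift (x △ D)} {lift x} (inj₁ lift≡0)
    ... | inj₂ _ | inj₁ lift≡0 = product-vanishes {lift (x △ D)} {lift x} (inj₂ lift≡0)
    ... | inj₂ (_ , A , A∈T , x△D≈A) | inj₂ (_ , B , B∈T , x≈B) =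
      contradiction (trans (size (△-upToComplement x△D≈A x≈B)) (sym n/2≡m)) (proj₂ (proj₂ T-independent) A B A∈T B∈T)
      where
      |x△D△x|≡m : ∣ (x △ D) △ x ∣ ≡ m
      |x△D△x|≡m = trans (cong ∣_∣ (△-cancelˡ x D)) |D|≡m
      size : UpToComplement (A △ B) ((x △ D) △ x) → ∣ A △ B ∣ ≡ m
      size (inj₁ eq) = trans (cong ∣_∣ (sym eq)) |x△D△x|≡m
      size (inj₂ eq) = ℕ.+-cancelʳ-≡ m ∣ A △ B ∣ m (begin
        ∣ A △ B ∣ ℕ.+ m ≡⟨ cong (∣ A △ B ∣ ℕ.+_) (trans (sym |x△D△x|≡m) (trans (cong ∣_∣ eq) (∣∁p∣≡n∸∣p∣ (A △ B)))) ⟩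
        ∣ A △ B ∣ ℕ.+ (n ℕ.∸ ∣ A △ B ∣) ≡⟨ ℕ.m+[n∸m]≡n (∣p∣≤n (A △ B)) ⟩
        n ∎)

    ∑-lift : ∑ lift ≡ + 2 * + length T
    ∑-lift = begin
      ∑ lift ≡⟨ ∑-+ {n} (indicator T) (λ x → indicator T (∁ x)) ⟩
      ∑ (indicator T) + ∑ (λ x → indicator T (∁ x)) ≡⟨ cong (λ s → ∑ (indicator T) + s) (∑-∁ (indicator T)) ⟩
      ∑ (indicator T) + ∑ (indicator T) ≡⟨ cong (λ s → s + s) (∑-indicator (proj₁ T-independent)) ⟩
      + length T + + length T ≡⟨ double (+ length T) ⟩
      + 2 * + length T ∎
      where
      double : ∀ a → a + a ≡ + 2 * a
      double = solve-∀

    lift-vertex : ∀ {A} → IsVertex n A → lift A ≡ indicator T A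
    lift-vertex {A} A-vertex = trans (cong (λ s → indicator T A + s) (indicator-∉ (∁-nonvertex A-vertex))) (+-identityʳ _)

module MultipleOfFour {h : ℕ} (0<h : 0 ℕ.< h) where

  open import Data.Nat using (_+_; _*_; _^_; _≤_)
  import Data.Nat.Properties as ℕ
  open import Data.Integer as ℤ using (ℤ; +_; 0ℤ; 1ℤ)
  import Data.Integer.Properties as ℤ
  open import Data.Integer.Tactic.RingSolver using (solve-∀)
  open import Data.Rational as ℚ using (ℚ)
  import Data.Rational.Properties as ℚ
  open import Data.Rational.Literals using (fromℤ)
  import Data.Bool as Bool
  open import Data.Vec.Properties using (≡-dec)
  open import Data.List using (List; map; length)
  import Data.List.Properties as List
  import Data.List.Membership.DecPropositional as DecMembership
  open import Data.Fin using (Fin)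
  open import Data.Fin.Subset using (Subset; ∣_∣; _∩_)
  open import Data.Product using (Σ; _×_; _,_; proj₁; proj₂)
  open import Algebra.Properties.CommutativeSemigroup ℤ.*-commutativeSemigroup using (x∙yz≈y∙zx)
  open import Relation.Binary.PropositionalEquality
  open import Relation.Nullary using (yes; no)
  open import Defs
  open ≡-Reasoning
  open HammingLevels
  open CubeSum using (∑)
  open Walsh using (walsh; walsh-comm; walsh-⊤-even)
  open PairSums
  open Rationals
  open Vertices

  m : ℕ
  m = h + h

  n : ℕ
  n = m + m

  open RatioBound {m} {h} refl 0<h using (ι; module IndependentIndicator)
  open IntegerFacts using (pos-2^)

  module Lift (T : List (Subset n)) (T-independent : IsIndependent n T) where
    open IndependentSet (ℕ.+-mono-< 0<h 0<h) T T-independent public using (lift; ∑-lift; lift-vertex)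
    open IndependentSet (ℕ.+-mono-< 0<h 0<h) T T-independent using (lift-idempotent; lift-even; lift-independent)
    open IndependentIndicator lift lift-idempotent lift-even lift-independent public using (S; F; ratio-bound; decomposition)

  2n[2L]≡4nL : ∀ L → + 2 ℤ.* (+ n ℤ.* (+ 2 ℤ.* + L)) ≡ + (4 * n * L)
  2n[2L]≡4nL L = trans (regroup (+ n) (+ L)) (trans (cong (ℤ._* + L) (sym (ℤ.pos-* 4 n))) (sym (ℤ.pos-* (4 * n) L)))
    where
    regroup : ∀ a b → + 2 ℤ.* (a ℤ.* (+ 2 ℤ.* b)) ≡ + 4 ℤ.* a ℤ.* b
    regroup = solve-∀

  independence-bound : (I : List (Subset n)) → IsIndependent n I → 4 * n * length I ≤ 2 ^ n
  independence-bound I I-independent =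
    ℤ.drop‿+≤+ (subst₂ ℤ._≤_ (trans (cong (λ s → + 2 ℤ.* (+ n ℤ.* s)) ∑-lift) (2n[2L]≡4nL (length I))) (pos-2^ n) ratio-bound)
    where open Lift I I-independent

  χ≡fromℤ-indicator : ∀ T A → χ T A ≡ fromℤ (indicator T A)
  χ≡fromℤ-indicator T A with A ∈? T
    where open DecMembership (≡-dec {n = n} Bool._≟_) using (_∈?_)
  ... | yes _ = refl
  ... | no _ = refl

  H≡walsh : ∀ (A : Subset n) p → H A p ≡ fromℤ (walsh (pairSet p) A)
  H≡walsh A p = trans (signPow≡fromℤ ∣ A ∩ pairSet p ∣) (cong fromℤ (walsh-comm A (pairSet p)))

  2^n≢0 : (+ 2) ℤ.^ n ≢ 0ℤ
  2^n≢0 2^n≡0 = ℕ.>⇒≢ (ℕ.m^n>0 2 n) (ℤ.+-injective (trans (sym (pos-2^ n)) 2^n≡0))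

  maximum-in-column-space : (Σ (List (Subset n)) λ I → IsMaximumIndependent n I × 4 * n * length I ≡ 2 ^ n) →
    (T : List (Subset n)) → IsMaximumIndependent n T → InColumnSpaceH~ n (χ T)
  maximum-in-column-space (I , (I-independent , _) , I-tight) T (T-independent , T-maximum) = c , d , representation
    where
    open Lift T T-independent
    T-tight : 4 * n * length T ≡ 2 ^ n
    T-tight = ℕ.≤-antisym (independence-bound T T-independent)
      (subst (_≤ 4 * n * length T) I-tight (ℕ.*-monoʳ-≤ (4 * n) (T-maximum I I-independent)))
    tight : + 2 ℤ.* (+ n ℤ.* S) ≡ (+ 2) ℤ.^ n
    tight = trans (cong (λ s → + 2 ℤ.* (+ n ℤ.* s)) ∑-lift) (trans (2n[2L]≡4nL (length T)) (trans (cong +_ T-tight) (sym (pos-2^ n))))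
    μ : ℤ
    μ = 1ℤ ℤ.+ ι
    r : ℚ
    r = proj₁ (fromℤ-inverse 2^n≢0)
    2^n·r≡1 : fromℤ ((+ 2) ℤ.^ n) ℚ.* r ≡ ℚ.1ℚ
    2^n·r≡1 = proj₂ (fromℤ-inverse 2^n≢0)
    c : Fin n × Fin n → ℚ
    c p = fromℤ (μ ℤ.* F (pairSet p)) ℚ.* r
    d : ℚ
    d = fromℤ (+ 2 ℤ.* S) ℚ.* r
    fourier-expansion : ∀ A → IsVertex n A →
      sumℤ (map (λ p → walsh (pairSet p) A ℤ.* (μ ℤ.* F (pairSet p))) (twoSubsets n)) ℤ.+ + 2 ℤ.* S ≡ (+ 2) ℤ.^ n ℤ.* lift A
    fourier-expansion A A-vertex = begin
      sumℤ (map (λ p → walsh (pairSet p) A ℤ.* (μ ℤ.* F (pairSet p))) (twoSubsets n)) ℤ.+ + 2 ℤ.* S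
        ≡⟨ cong (λ L → sumℤ L ℤ.+ + 2 ℤ.* S) (List.map-cong (λ p → x∙yz≈y∙zx (walsh (pairSet p) A) μ (F (pairSet p))) (twoSubsets n)) ⟩
      sumℤ (map (λ p → μ ℤ.* u (pairSet p)) (twoSubsets n)) ℤ.+ + 2 ℤ.* S
        ≡⟨ cong (ℤ._+ + 2 ℤ.* S) (sumℤ-*ˡ μ (λ p → u (pairSet p)) (twoSubsets n)) ⟩
      μ ℤ.* sumℤ (map (λ p → u (pairSet p)) (twoSubsets n)) ℤ.+ + 2 ℤ.* S
        ≡⟨ cong (λ x → μ ℤ.* x ℤ.+ + 2 ℤ.* S) (trans (sumℤ-twoSubsets n u) (sym (∑-level-2 n u))) ⟩
      μ ℤ.* ∑ (λ J → 𝟙[ ∣ J ∣ ≡ 2 ] ℤ.* u J) ℤ.+ + 2 ℤ.* S ≡⟨ ℤ.+-comm (μ ℤ.* ∑ (λ J → 𝟙[ ∣ J ∣ ≡ 2 ] ℤ.* u J)) (+ 2 ℤ.* S) ⟩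
      + 2 ℤ.* S ℤ.+ μ ℤ.* ∑ (λ J → 𝟙[ ∣ J ∣ ≡ 2 ] ℤ.* u J) ≡⟨ decomposition A (walsh-⊤-even {x = A} (proj₁ A-vertex)) tight ⟨
      (+ 2) ℤ.^ n ℤ.* lift A ∎
      where
      u : Subset n → ℤ
      u J = F J ℤ.* walsh J A
    representation : ∀ A → IsVertex n A → χ T A ≡ sumℚ (map (λ p → H A p ℚ.* c p) (twoSubsets n)) ℚ.+ d
    representation A A-vertex = begin
      χ T A ≡⟨ χ≡fromℤ-indicator T A ⟩
      fromℤ (indicator T A) ≡⟨ cong fromℤ (lift-vertex A-vertex) ⟨
      fromℤ (lift A)
        ≡⟨ sumℚ-divide (twoSubsets n) (λ p → walsh (pairSet p) A) (λ p → μ ℤ.* F (pairSet p)) {s = + 2 ℤ.* S} {r = r}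
                       2^n·r≡1 (fourier-expansion A A-vertex) ⟨
      sumℚ (map (λ p → fromℤ (walsh (pairSet p) A) ℚ.* c p) (twoSubsets n)) ℚ.+ d
        ≡⟨ cong (λ q → sumℚ q ℚ.+ d) (List.map-cong (λ p → cong (ℚ._* c p) (H≡walsh A p)) (twoSubsets n)) ⟨
      sumℚ (map (λ p → H A p ℚ.* c p) (twoSubsets n)) ℚ.+ d ∎

open import Defs
open import Data.Nat using (ℕ; _*_; _≤_; _<_; _^_)
open import Data.Nat.Divisibility using (_∣_)
open import Data.List using (List; length)
open import Data.Fin.Subset using (Subset)
open import Data.Product using (_×_; Σ)
open import Relation.Binary.PropositionalEquality using (_≡_)
open import Data.Nat using (_+_)
open import Data.Nat.Divisibility using (divides)
open import Data.Product using (∃-syntax; _,_)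
open import Relation.Binary.PropositionalEquality using (refl; sym; trans; cong)
import Data.Nat.Properties as ℕ
import Data.Nat.Tactic.RingSolver as NatSolver

fourfold : ∀ {n} → 0 < n → 4 ∣ n → ∃[ h ] (0 < h × n ≡ (h + h) + (h + h))
fourfold {n} 0<n (divides h n≡h*4) = h , 0<h , trans n≡h*4 (quadruple h)
  where
  quadruple : ∀ h → h * 4 ≡ (h + h) + (h + h)
  quadruple = NatSolver.solve-∀
  0<h : 0 < h
  0<h = ℕ.n≢0⇒n>0 (λ h≡0 → ℕ.<⇒≢ 0<n (sym (trans n≡h*4 (cong (_* 4) h≡0))))

mainTheorem3 : (n : ℕ) → 0 < n → 4 ∣ n →
    ((S : List (Subset n)) → IsIndependent n S → 4 * n * length S ≤ 2 ^ n)
    × ((Σ (List (Subset n)) λ S → IsMaximumIndependent n S × 4 * n * length S ≡ 2 ^ n) →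
    (T : List (Subset n)) → IsMaximumIndependent n T → InColumnSpaceH~ n (χ T))
mainTheorem3 n 0<n 4∣n with fourfold 0<n 4∣n
... | h , 0<h , refl = independence-bound , maximum-in-column-space
  where open MultipleOfFour 0<h
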